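{- Let $x,y\in\{0,1\}^n$ with $d(x,y)=w$, and let $\lambda(x,y)=\frac12\sum_{u\in\{0,1\}^n}|d(x,u)-d(y,u)|$. Then $$\lambda(x,y)=\lambda(w)=\sum_{k=0}^n\hat\lambda_kK_k^{(n)}(w),$$ with $\hat\lambda_0=\Lambda_n=\frac n{2^{n+1}}\binom{2n}n$ and $\hat\lambda_k=-2^{ -n}\sum_{t=0}^{n-1}\big(K_t^{(n-1)}(k-1)\big)^2$ for $k=1,\dots,n$. Thus the kernel $-\lambda(x,y)$ is positive definite up to an additive constant (all coefficients $-\hat\lambda_k$, $k\ge1$, are nonnegative).
   Context: $d$ is the Hamming distance. The Krawtchouk polynomials are $K_k^{(n)}(x)=\sum_{i=0}^k(-1)^i\binom xi\binom{n-x}{k-i}$, $k=0,\dots,n$. -}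

module Defs where

open import Data.Bool using (Bool; true; false; _xor_)
open import Data.Nat as ℕ using (ℕ; zero; suc; _∸_)
open import Data.Nat.Combinatorics using (_C_)
open import Data.Integer as ℤ using (ℤ; +_)
open import Data.Rational using (ℚ; _/_; _+_; _*_; -_; _-_; ∣_∣; 0ℚ; 1ℚ)
open import Data.List using (List; []; _∷_; map; concatMap; upTo)
open import Data.Vec using (Vec; []; _∷_)

allVecs : (n : ℕ) → List (Vec Bool n)
allVecs zero = [] ∷ []
allVecs (suc n) = concatMap (λ v → (false ∷ v) ∷ (true ∷ v) ∷ []) (allVecs n)

ham : {n : ℕ} → Vec Bool n → Vec Bool n → ℕ
ham [] [] = 0
ham (a ∷ x) (b ∷ y) with a xor b
... | true  = suc (ham x y)
... | false = ham x y

toℚ : ℕ → ℚ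
toℚ m = (+ m) / 1

sumℚ : List ℚ → ℚ
sumℚ [] = 0ℚ
sumℚ (q ∷ qs) = q + sumℚ qs

sumTo : ℕ → (ℕ → ℚ) → ℚ
sumTo k f = sumℚ (map f (upTo (suc k)))

pow2inv : ℕ → ℚ
pow2inv zero = 1ℚ
pow2inv (suc n) = ((+ 1) / 2) * pow2inv n

sgn : ℕ → ℚ
sgn zero = 1ℚ
sgn (suc i) = - sgn i

-- Krawtchouk polynomial K_k^{(n)}(x) = Σ_{i=0}^k (-1)^i C(x,i) C(n-x,k-i)
-- (evaluated at natural x; used only for 0 ≤ x ≤ n)
kraw : (n k x : ℕ) → ℚ
kraw n k x = sumTo k (λ i → sgn i * toℚ ((x C i) ℕ.* ((n ∸ x) C (k ∸ i))))

lam : {n : ℕ} → Vec Bool n → Vec Bool n → ℚ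
lam {n} x y = ((+ 1) / 2) * sumℚ (map (λ u → ∣ toℚ (ham x u) - toℚ (ham y u) ∣) (allVecs n))

lamHat : (n k : ℕ) → ℚ
lamHat n zero = toℚ (n ℕ.* ((2 ℕ.* n) C n)) * pow2inv (suc n)
lamHat n (suc j) =
  - (pow2inv n * sumTo (n ∸ 1) (λ t → kraw (n ∸ 1) t j * kraw (n ∸ 1) t j))

-- The layer-cake formula |a - b| = Σ_{r ≤ n} ([a < r] - [b < r])² writes
-- 2λ(x, y) as Σ_r ‖1_{B_r(x)} - 1_{B_r(y)}‖², where B_r(x) = {u : d(x, u) < r}.
-- By translation invariance and the evaluation of character sums of radial
-- functions, the Walsh–Fourier transform of 1_{B_r(x)} at z is χ_z(x) Σ_{i<r} K_i(|z|);
-- Parseval's identity on (ℤ/2)ⁿ therefore gives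
--   λ(x, y) = 2⁻ⁿ Σ_z H(|z|) (1 - χ_z(x ⊕ y)),   H(k) = Σ_r (Σ_{i<r} K_i(k))²,
-- and a second radial character sum gives λ = Σ_r V_r - 2⁻ⁿ Σ_k H(k) K_k(w), with V_r
-- the volume of a ball.  For k ≥ 1 the partial sums Σ_{i<r} K_i(k) telescope to
-- Krawtchouk values of order n-1, which gives λ̂_k.  The constant term
-- Σ_r V_r - 2⁻ⁿ Σ_r V_r² = 2⁻ⁿ Σ_{u,v} (|v| ∸ |u|) is evaluated by a recursion in n.

module Submission where

open import Defs
open import Data.Bool using (Bool; true; false; _xor_)
open import Data.Nat as ℕ using (ℕ; zero; suc; _∸_; _<ᵇ_; _≡ᵇ_)
import Data.Nat.Properties as NP
open import Data.Nat.Combinatorics using (_C_; k>n⇒nCk≡0; nCk+nC[k+1]≡[n+1]C[k+1]; nCk≡nC[n∸k]; nC1≡n)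
open import Data.Nat.Coprimality using (1-coprimeTo)
import Data.Nat.Coprimality as Coprime
import Data.Integer as ℤ
import Data.Integer.Properties as ZP
open import Data.Rational as Q using (ℚ; mkℚ; _+_; _*_; -_; _-_; 0ℚ; 1ℚ; ∣_∣; _≤_; ½)
import Data.Rational.Properties as QP
open import Data.Rational.Solver using (module +-*-Solver)
open import Data.List using (List; []; _∷_; map; concatMap; upTo)
import Data.List.Properties as LP
open import Data.Vec using (Vec; []; _∷_; zipWith)
open import Data.Product using (_×_; _,_)
open import Data.Sum using (inj₁; inj₂)
open import Relation.Binary.PropositionalEquality
open import Relation.Nullary using (yes; no)
open import Function using (_∘_)

module Binomial where
  open import Data.Nat.Solver using () renaming (module +-*-Solver to ℕ-Solver)
  open ℕ-Solver

  pascal² : ∀ N j → suc (suc N) C suc (suc j) ≡ (N C suc (suc j) ℕ.+ (N C suc j ℕ.+ N C suc j)) ℕ.+ N C j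
  pascal² N j = begin
    suc (suc N) C suc (suc j)                           ≡⟨ sym (nCk+nC[k+1]≡[n+1]C[k+1] (suc N) (suc j)) ⟩
    suc N C suc j ℕ.+ suc N C suc (suc j)                 ≡⟨ cong₂ ℕ._+_ (sym (nCk+nC[k+1]≡[n+1]C[k+1] N j)) (sym (nCk+nC[k+1]≡[n+1]C[k+1] N (suc j))) ⟩
    (N C j ℕ.+ N C suc j) ℕ.+ (N C suc j ℕ.+ N C suc (suc j)) ≡⟨ solve 3 (λ a b c → (a :+ b) :+ (b :+ c) := (c :+ (b :+ b)) :+ a) refl (N C j) (N C suc j) (N C suc (suc j)) ⟩
    (N C suc (suc j) ℕ.+ (N C suc j ℕ.+ N C suc j)) ℕ.+ N C j ∎
    where open ≡-Reasoning

  pascal²-1 : ∀ N → suc (suc N) C 1 ≡ (N C 1 ℕ.+ (N C 0 ℕ.+ N C 0)) ℕ.+ 0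
  pascal²-1 N = begin
    suc (suc N) C 1                 ≡⟨ nC1≡n (suc (suc N)) ⟩
    suc (suc N)                     ≡⟨ solve 1 (λ N → con 2 :+ N := (N :+ (con 1 :+ con 1)) :+ con 0) refl N ⟩
    (N ℕ.+ (1 ℕ.+ 1)) ℕ.+ 0               ≡⟨ cong (λ q → (q ℕ.+ (1 ℕ.+ 1)) ℕ.+ 0) (sym (nC1≡n N)) ⟩
    (N C 1 ℕ.+ (N C 0 ℕ.+ N C 0)) ℕ.+ 0   ∎
    where open ≡-Reasoning

  absorb : ∀ N k → suc k ℕ.* (suc N C suc k) ≡ suc N ℕ.* (N C k)
  absorb zero    zero    = refl
  absorb zero    (suc k) = NP.*-zeroʳ (suc (suc k))
  absorb (suc N) zero    = trans (NP.*-identityˡ (suc (suc N) C 1)) (trans (nC1≡n (suc (suc N))) (sym (NP.*-identityʳ (suc (suc N)))))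
  absorb (suc N) (suc k) = begin
    suc (suc k) ℕ.* (suc (suc N) C suc (suc k))   ≡⟨ cong (suc (suc k) ℕ.*_) (sym (nCk+nC[k+1]≡[n+1]C[k+1] (suc N) (suc k))) ⟩
    suc (suc k) ℕ.* (a ℕ.+ b)                       ≡⟨ solve 3 (λ k a b → (con 2 :+ k) :* (a :+ b) := a :+ (con 1 :+ k) :* a :+ (con 2 :+ k) :* b) refl k a b ⟩
    a ℕ.+ suc k ℕ.* a ℕ.+ suc (suc k) ℕ.* b             ≡⟨ cong₂ (λ p q → a ℕ.+ p ℕ.+ q) (absorb N k) (absorb N (suc k)) ⟩
    a ℕ.+ suc N ℕ.* (N C k) ℕ.+ suc N ℕ.* (N C suc k)   ≡⟨ solve 4 (λ a N c d → a :+ (con 1 :+ N) :* c :+ (con 1 :+ N) :* d := a :+ (con 1 :+ N) :* (c :+ d)) refl a N (N C k) (N C suc k) ⟩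
    a ℕ.+ suc N ℕ.* (N C k ℕ.+ N C suc k)             ≡⟨ cong (λ q → a ℕ.+ suc N ℕ.* q) (nCk+nC[k+1]≡[n+1]C[k+1] N k) ⟩
    suc (suc N) ℕ.* a                             ∎
    where
    open ≡-Reasoning
    a = suc N C suc k
    b = suc N C suc (suc k)

  central : ∀ n → suc n ℕ.* ((2 ℕ.* suc n) C suc n) ≡ 4 ℕ.* (n ℕ.* ((2 ℕ.* n) C n)) ℕ.+ 2 ℕ.* ((2 ℕ.* n) C n)
  central n = begin
    suc n ℕ.* ((2 ℕ.* suc n) C suc n)              ≡⟨ cong (λ q → suc n ℕ.* (q C suc n)) 2[n+1]≡2+N ⟩
    suc n ℕ.* (suc (suc N) C suc n)              ≡⟨ cong (suc n ℕ.*_) (sym (nCk+nC[k+1]≡[n+1]C[k+1] (suc N) n)) ⟩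
    suc n ℕ.* (suc N C n ℕ.+ suc N C suc n)        ≡⟨ cong (λ q → suc n ℕ.* (q ℕ.+ suc N C suc n)) symmetric ⟩
    suc n ℕ.* (suc N C suc n ℕ.+ suc N C suc n)    ≡⟨ solve 2 (λ n c → (con 1 :+ n) :* (c :+ c) := con 2 :* ((con 1 :+ n) :* c)) refl n (suc N C suc n) ⟩
    2 ℕ.* (suc n ℕ.* (suc N C suc n))              ≡⟨ cong (2 ℕ.*_) (absorb N n) ⟩
    2 ℕ.* (suc N ℕ.* (N C n))                      ≡⟨ cong (λ q → 2 ℕ.* (suc q ℕ.* (q C n)) ) N≡2n ⟩
    2 ℕ.* (suc (2 ℕ.* n) ℕ.* ((2 ℕ.* n) C n))          ≡⟨ solve 2 (λ n c → con 2 :* ((con 1 :+ con 2 :* n) :* c) := con 4 :* (n :* c) :+ con 2 :* c) refl n ((2 ℕ.* n) C n) ⟩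
    4 ℕ.* (n ℕ.* ((2 ℕ.* n) C n)) ℕ.+ 2 ℕ.* ((2 ℕ.* n) C n) ∎
    where
    open ≡-Reasoning
    N = n ℕ.+ n
    N≡2n : N ≡ 2 ℕ.* n
    N≡2n = cong (n ℕ.+_) (sym (NP.+-identityʳ n))
    2[n+1]≡2+N : 2 ℕ.* suc n ≡ suc (suc N)
    2[n+1]≡2+N = trans (cong (suc n ℕ.+_) (NP.+-identityʳ (suc n))) (cong suc (NP.+-suc n n))
    symmetric : suc N C n ≡ suc N C suc n
    symmetric = trans (nCk≡nC[n∸k] (NP.m≤n⇒m≤1+n (NP.m≤m+n n n)))
                      (cong (suc N C_) (trans (NP.+-∸-assoc 1 (NP.m≤m+n n n)) (cong suc (NP.m+n∸m≡n n n))))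

open Binomial
open +-*-Solver

integral : ℕ → ℚ
integral m = mkℚ (ℤ.+ m) 0 (Coprime.sym (1-coprimeTo m))

toℚ-integral : ∀ m → toℚ m ≡ integral m
toℚ-integral m = QP.normalize-coprime _

-- The sum (resp. product) of two integral rationals is computed as the
-- normalisation of a·1 + b·1 (resp. a·b) over 1·1.
toℚ-+ : ∀ a b → toℚ (a ℕ.+ b) ≡ toℚ a + toℚ b
toℚ-+ a b = begin
  toℚ (a ℕ.+ b)                 ≡⟨ cong (Q._/ 1) (cong₂ ℤ._+_ (sym (ZP.*-identityʳ (ℤ.+ a))) (sym (ZP.*-identityʳ (ℤ.+ b)))) ⟩
  integral a + integral b       ≡⟨ cong₂ _+_ (sym (toℚ-integral a)) (sym (toℚ-integral b)) ⟩
  toℚ a + toℚ b                 ∎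
  where open ≡-Reasoning

toℚ-* : ∀ a b → toℚ (a ℕ.* b) ≡ toℚ a * toℚ b
toℚ-* a b = begin
  toℚ (a ℕ.* b)                 ≡⟨ cong (Q._/ 1) (ZP.pos-* a b) ⟩
  integral a * integral b       ≡⟨ cong₂ _*_ (sym (toℚ-integral a)) (sym (toℚ-integral b)) ⟩
  toℚ a * toℚ b                 ∎
  where open ≡-Reasoning

toℚ-nonNeg : ∀ m → 0ℚ ≤ toℚ m
toℚ-nonNeg m = QP.nonNegative⁻¹ (toℚ m) {{QP.normalize-nonNeg m 1}}

∣toℚ-toℚ∣ : ∀ a b → ∣ toℚ a - toℚ b ∣ ≡ toℚ (b ∸ a) + toℚ (a ∸ b)
∣toℚ-toℚ∣ zero b = begin
  ∣ 0ℚ - toℚ b ∣      ≡⟨ cong ∣_∣ (QP.+-identityˡ (- toℚ b)) ⟩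
  ∣ - toℚ b ∣         ≡⟨ QP.∣-p∣≡∣p∣ (toℚ b) ⟩
  ∣ toℚ b ∣           ≡⟨ QP.0≤p⇒∣p∣≡p (toℚ-nonNeg b) ⟩
  toℚ b               ≡⟨ sym (QP.+-identityʳ (toℚ b)) ⟩
  toℚ b + toℚ 0       ≡⟨ cong (λ d → toℚ b + toℚ d) (sym (NP.0∸n≡0 b)) ⟩
  toℚ b + toℚ (0 ∸ b) ∎
  where open ≡-Reasoning
∣toℚ-toℚ∣ (suc a) zero = begin
  ∣ toℚ (suc a) - 0ℚ ∣  ≡⟨ cong ∣_∣ (QP.+-identityʳ (toℚ (suc a))) ⟩
  ∣ toℚ (suc a) ∣       ≡⟨ QP.0≤p⇒∣p∣≡p (toℚ-nonNeg (suc a)) ⟩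
  toℚ (suc a)           ≡⟨ sym (QP.+-identityˡ (toℚ (suc a))) ⟩
  toℚ 0 + toℚ (suc a)   ∎
  where open ≡-Reasoning
∣toℚ-toℚ∣ (suc a) (suc b) = trans (cong ∣_∣ cancel-1) (∣toℚ-toℚ∣ a b)
  where
  cancel-1 : toℚ (suc a) - toℚ (suc b) ≡ toℚ a - toℚ b
  cancel-1 = trans (cong₂ _-_ (toℚ-+ 1 a) (toℚ-+ 1 b))
    (solve 2 (λ x y → (con 1ℚ :+ x) :- (con 1ℚ :+ y) := x :- y) refl (toℚ a) (toℚ b))

ind : Bool → ℚ
ind true  = 1ℚ
ind false = 0ℚ

ind-idem : ∀ b → ind b * ind b ≡ ind b
ind-idem true  = refl
ind-idem false = refl

∑ₗ : {A : Set} → List A → (A → ℚ) → ℚ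
∑ₗ l f = sumℚ (map f l)

module _ {A : Set} where

  ∑ₗ-cong : (l : List A) {f g : A → ℚ} → (∀ x → f x ≡ g x) → ∑ₗ l f ≡ ∑ₗ l g
  ∑ₗ-cong []      e = refl
  ∑ₗ-cong (x ∷ l) e = cong₂ _+_ (e x) (∑ₗ-cong l e)

  ∑ₗ-0 : (l : List A) → ∑ₗ l (λ _ → 0ℚ) ≡ 0ℚ
  ∑ₗ-0 []      = refl
  ∑ₗ-0 (x ∷ l) = trans (QP.+-identityˡ _) (∑ₗ-0 l)

  ∑ₗ-+ : (l : List A) (f g : A → ℚ) → ∑ₗ l (λ x → f x + g x) ≡ ∑ₗ l f + ∑ₗ l g
  ∑ₗ-+ []      f g = refl
  ∑ₗ-+ (x ∷ l) f g = trans (cong (f x + g x +_) (∑ₗ-+ l f g))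
    (solve 4 (λ a b c d → (a :+ b) :+ (c :+ d) := (a :+ c) :+ (b :+ d)) refl (f x) (g x) (∑ₗ l f) (∑ₗ l g))

  ∑ₗ-neg : (l : List A) (f : A → ℚ) → ∑ₗ l (λ x → - f x) ≡ - ∑ₗ l f
  ∑ₗ-neg []      f = refl
  ∑ₗ-neg (x ∷ l) f = trans (cong (- f x +_) (∑ₗ-neg l f)) (sym (QP.neg-distrib-+ (f x) (∑ₗ l f)))

  ∑ₗ-- : (l : List A) (f g : A → ℚ) → ∑ₗ l (λ x → f x - g x) ≡ ∑ₗ l f - ∑ₗ l g
  ∑ₗ-- l f g = trans (∑ₗ-+ l f (λ x → - g x)) (cong (∑ₗ l f +_) (∑ₗ-neg l g))

  ∑ₗ-*ˡ : (l : List A) (c : ℚ) (f : A → ℚ) → ∑ₗ l (λ x → c * f x) ≡ c * ∑ₗ l f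
  ∑ₗ-*ˡ []      c f = sym (QP.*-zeroʳ c)
  ∑ₗ-*ˡ (x ∷ l) c f = trans (cong (c * f x +_) (∑ₗ-*ˡ l c f)) (sym (QP.*-distribˡ-+ c (f x) (∑ₗ l f)))

  ∑ₗ-*ʳ : (l : List A) (c : ℚ) (f : A → ℚ) → ∑ₗ l (λ x → f x * c) ≡ ∑ₗ l f * c
  ∑ₗ-*ʳ l c f = trans (∑ₗ-cong l (λ x → QP.*-comm (f x) c)) (trans (∑ₗ-*ˡ l c f) (QP.*-comm c _))

∑ₗ-swap : {A B : Set} (l : List A) (m : List B) (f : A → B → ℚ) →
  ∑ₗ l (λ a → ∑ₗ m (f a)) ≡ ∑ₗ m (λ b → ∑ₗ l (λ a → f a b))
∑ₗ-swap []      m f = sym (∑ₗ-0 m)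
∑ₗ-swap (x ∷ l) m f = trans (cong (∑ₗ m (f x) +_) (∑ₗ-swap l m f))
  (sym (∑ₗ-+ m (f x) (λ b → ∑ₗ l (λ a → f a b))))

-- Sums over a range: ∑< k f = Σ_{i<k} f i.  (sumTo n f = ∑< (suc n) f.)
∑< : ℕ → (ℕ → ℚ) → ℚ
∑< k f = ∑ₗ (upTo k) f

∑<-shift : ∀ k f → ∑< (suc k) f ≡ f 0 + ∑< k (f ∘ suc)
∑<-shift k f = cong (λ l → f 0 + sumℚ l)
  (trans (LP.map-applyUpTo suc f k) (sym (LP.map-applyUpTo (λ i → i) (f ∘ suc) k)))

∑<-snoc : ∀ k f → ∑< (suc k) f ≡ ∑< k f + f k
∑<-snoc zero    f = QP.+-comm (f 0) 0ℚ
∑<-snoc (suc k) f = begin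
  ∑< (suc (suc k)) f                 ≡⟨ ∑<-shift (suc k) f ⟩
  f 0 + ∑< (suc k) (f ∘ suc)         ≡⟨ cong (f 0 +_) (∑<-snoc k (f ∘ suc)) ⟩
  f 0 + (∑< k (f ∘ suc) + f (suc k)) ≡⟨ sym (QP.+-assoc (f 0) _ _) ⟩
  (f 0 + ∑< k (f ∘ suc)) + f (suc k) ≡⟨ cong (_+ f (suc k)) (sym (∑<-shift k f)) ⟩
  ∑< (suc k) f + f (suc k)           ∎
  where open ≡-Reasoning

∑<-cong : ∀ k {f g : ℕ → ℚ} → (∀ i → i ℕ.< k → f i ≡ g i) → ∑< k f ≡ ∑< k g
∑<-cong zero    e = refl
∑<-cong (suc k) {f} {g} e = begin
  ∑< (suc k) f              ≡⟨ ∑<-shift k f ⟩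
  f 0 + ∑< k (f ∘ suc)      ≡⟨ cong₂ _+_ (e 0 (ℕ.s≤s ℕ.z≤n)) (∑<-cong k (λ i i<k → e (suc i) (ℕ.s≤s i<k))) ⟩
  g 0 + ∑< k (g ∘ suc)      ≡⟨ sym (∑<-shift k g) ⟩
  ∑< (suc k) g              ∎
  where open ≡-Reasoning

∑<-vanish : ∀ k (f : ℕ → ℚ) → (∀ i → f i ≡ 0ℚ) → ∑< k f ≡ 0ℚ
∑<-vanish k f e = trans (∑ₗ-cong (upTo k) e) (∑ₗ-0 (upTo k))

∑□ : (n : ℕ) → (Vec Bool n → ℚ) → ℚ
∑□ n f = ∑ₗ (allVecs n) f

∑□-suc : ∀ n (f : Vec Bool (suc n) → ℚ) → ∑□ (suc n) f ≡ ∑□ n (λ v → f (false ∷ v) + f (true ∷ v))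
∑□-suc n f = go (allVecs n)
  where
  go : (l : List (Vec Bool n)) →
    ∑ₗ (concatMap (λ v → (false ∷ v) ∷ (true ∷ v) ∷ []) l) f ≡ ∑ₗ l (λ v → f (false ∷ v) + f (true ∷ v))
  go []      = refl
  go (v ∷ l) = trans (sym (QP.+-assoc (f (false ∷ v)) _ _)) (cong (f (false ∷ v) + f (true ∷ v) +_) (go l))

krawTerm : ℕ → ℕ → ℕ → ℕ → ℚ
krawTerm n k x i = sgn i * toℚ ((x C i) ℕ.* ((n ∸ x) C (k ∸ i)))

scaled-toℚ-+ : ∀ s a b → s * toℚ (a ℕ.+ b) ≡ s * toℚ a + s * toℚ b
scaled-toℚ-+ s a b = trans (cong (s *_) (toℚ-+ a b)) (QP.*-distribˡ-+ s (toℚ a) (toℚ b))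

kraw-suc-suc : ∀ n k w → kraw (suc n) (suc k) (suc w) ≡ kraw n (suc k) w - kraw n k w
kraw-suc-suc n k w = begin
  ∑< (suc (suc k)) (krawTerm (suc n) (suc k) (suc w))
    ≡⟨ ∑<-shift (suc k) (krawTerm (suc n) (suc k) (suc w)) ⟩
  T₁ 0 + ∑< (suc k) (λ i → krawTerm (suc n) (suc k) (suc w) (suc i))
    ≡⟨ cong (T₁ 0 +_) (trans (∑<-cong (suc k) (λ i _ → summand i)) (∑ₗ-- (upTo (suc k)) (T₁ ∘ suc) T₀)) ⟩
  T₁ 0 + (∑< (suc k) (T₁ ∘ suc) - ∑< (suc k) T₀)
    ≡⟨ sym (QP.+-assoc (T₁ 0) _ _) ⟩
  (T₁ 0 + ∑< (suc k) (T₁ ∘ suc)) - ∑< (suc k) T₀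
    ≡⟨ cong (_- ∑< (suc k) T₀) (sym (∑<-shift (suc k) T₁)) ⟩
  kraw n (suc k) w - kraw n k w ∎
  where
  open ≡-Reasoning
  T₁ = krawTerm n (suc k) w
  T₀ = krawTerm n k w
  summand : ∀ i → krawTerm (suc n) (suc k) (suc w) (suc i) ≡ T₁ (suc i) - T₀ i
  summand i = begin
    - sgn i * toℚ ((suc w C suc i) ℕ.* c)
      ≡⟨ cong (λ q → - sgn i * toℚ (q ℕ.* c)) (sym (nCk+nC[k+1]≡[n+1]C[k+1] w i)) ⟩
    - sgn i * toℚ ((w C i ℕ.+ w C suc i) ℕ.* c)
      ≡⟨ trans (cong (λ q → - sgn i * toℚ q) (NP.*-distribʳ-+ c (w C i) (w C suc i))) (scaled-toℚ-+ (- sgn i) ((w C i) ℕ.* c) ((w C suc i) ℕ.* c)) ⟩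
    - sgn i * toℚ ((w C i) ℕ.* c) + - sgn i * toℚ ((w C suc i) ℕ.* c)
      ≡⟨ solve 3 (λ s a b → (:- s) :* a :+ (:- s) :* b := (:- s) :* b :- s :* a) refl (sgn i) (toℚ ((w C i) ℕ.* c)) (toℚ ((w C suc i) ℕ.* c)) ⟩
    T₁ (suc i) - T₀ i ∎
    where c = (n ∸ w) C (k ∸ i)

kraw-suc : ∀ n k w → w ℕ.≤ n → kraw (suc n) (suc k) w ≡ kraw n (suc k) w + kraw n k w
kraw-suc n k w w≤n = begin
  ∑< (suc (suc k)) (krawTerm (suc n) (suc k) w)
    ≡⟨ ∑<-snoc (suc k) (krawTerm (suc n) (suc k) w) ⟩
  ∑< (suc k) (krawTerm (suc n) (suc k) w) + krawTerm (suc n) (suc k) w (suc k)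
    ≡⟨ cong₂ _+_ (trans (∑<-cong (suc k) summand) (∑ₗ-+ (upTo (suc k)) T₁ T₀)) last ⟩
  (∑< (suc k) T₁ + ∑< (suc k) T₀) + T₁ (suc k)
    ≡⟨ solve 3 (λ a b c → (a :+ b) :+ c := (a :+ c) :+ b) refl (∑< (suc k) T₁) (∑< (suc k) T₀) (T₁ (suc k)) ⟩
  (∑< (suc k) T₁ + T₁ (suc k)) + ∑< (suc k) T₀
    ≡⟨ cong (_+ ∑< (suc k) T₀) (sym (∑<-snoc (suc k) T₁)) ⟩
  kraw n (suc k) w + kraw n k w ∎
  where
  open ≡-Reasoning
  T₁ = krawTerm n (suc k) w
  T₀ = krawTerm n k w
  m = n ∸ w
  last : krawTerm (suc n) (suc k) w (suc k) ≡ T₁ (suc k)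
  last = cong (λ j → sgn (suc k) * toℚ ((w C suc k) ℕ.* j))
    (trans (cong ((suc n ∸ w) C_) (NP.n∸n≡0 k)) (cong (m C_) (sym (NP.n∸n≡0 k))))
  summand : ∀ i → i ℕ.< suc k → krawTerm (suc n) (suc k) w i ≡ T₁ i + T₀ i
  summand i (ℕ.s≤s i≤k) = begin
    sgn i * toℚ ((w C i) ℕ.* ((suc n ∸ w) C (suc k ∸ i)))
      ≡⟨ cong (λ q → sgn i * toℚ ((w C i) ℕ.* q)) (cong₂ _C_ (NP.+-∸-assoc 1 w≤n) (NP.+-∸-assoc 1 i≤k)) ⟩
    sgn i * toℚ ((w C i) ℕ.* (suc m C suc (k ∸ i)))
      ≡⟨ cong (λ q → sgn i * toℚ ((w C i) ℕ.* q)) (sym (nCk+nC[k+1]≡[n+1]C[k+1] m (k ∸ i))) ⟩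
    sgn i * toℚ ((w C i) ℕ.* (m C (k ∸ i) ℕ.+ m C suc (k ∸ i)))
      ≡⟨ trans (cong (λ q → sgn i * toℚ q) (NP.*-distribˡ-+ (w C i) (m C (k ∸ i)) (m C suc (k ∸ i))))
           (scaled-toℚ-+ (sgn i) ((w C i) ℕ.* (m C (k ∸ i))) ((w C i) ℕ.* (m C suc (k ∸ i)))) ⟩
    T₀ i + sgn i * toℚ ((w C i) ℕ.* (m C suc (k ∸ i)))
      ≡⟨ QP.+-comm (T₀ i) _ ⟩
    sgn i * toℚ ((w C i) ℕ.* (m C suc (k ∸ i))) + T₀ i
      ≡⟨ cong (λ j → sgn i * toℚ ((w C i) ℕ.* (m C j)) + T₀ i) (sym (NP.+-∸-assoc 1 {k} {i} i≤k)) ⟩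
    T₁ i + T₀ i ∎

-- K_k^{(n)}(w) = 0 for w ≤ n < k: every summand contains a vanishing binomial.
kraw-vanish : ∀ n k w → n ℕ.< k → w ℕ.≤ n → kraw n k w ≡ 0ℚ
kraw-vanish n k w n<k w≤n = trans (∑<-cong (suc k) (λ i i<1+k → summand i (NP.<⇒≤pred i<1+k))) (∑<-vanish (suc k) (λ _ → 0ℚ) (λ _ → refl))
  where
  summand : ∀ i → i ℕ.≤ k → krawTerm n k w i ≡ 0ℚ
  summand i i≤k with i ℕ.≤? w
  ... | yes i≤w = begin
    sgn i * toℚ ((w C i) ℕ.* ((n ∸ w) C (k ∸ i))) ≡⟨ cong (λ q → sgn i * toℚ ((w C i) ℕ.* q)) (k>n⇒nCk≡0 lt) ⟩
    sgn i * toℚ ((w C i) ℕ.* 0)                   ≡⟨ cong (λ q → sgn i * toℚ q) (NP.*-zeroʳ (w C i)) ⟩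
    sgn i * 0ℚ                                    ≡⟨ QP.*-zeroʳ (sgn i) ⟩
    0ℚ                                            ∎
    where
    open ≡-Reasoning
    lt : n ∸ w ℕ.< k ∸ i
    lt = NP.<-≤-trans (NP.∸-monoˡ-< n<k w≤n) (NP.∸-monoʳ-≤ k i≤w)
  ... | no i≰w = trans (cong (λ q → sgn i * toℚ (q ℕ.* ((n ∸ w) C (k ∸ i)))) (k>n⇒nCk≡0 (NP.≰⇒> i≰w)))
                       (QP.*-zeroʳ (sgn i))

krawSum : ℕ → (ℕ → ℚ) → ℕ → ℚ
krawSum n F w = ∑< (suc n) (λ k → F k * kraw n k w)

krawSum-extend : ∀ n F w → w ℕ.≤ n → ∑< (suc (suc n)) (λ k → F k * kraw n k w) ≡ krawSum n F w
krawSum-extend n F w w≤n = begin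
  ∑< (suc (suc n)) (λ k → F k * kraw n k w)          ≡⟨ ∑<-snoc (suc n) (λ k → F k * kraw n k w) ⟩
  krawSum n F w + F (suc n) * kraw n (suc n) w       ≡⟨ cong (λ q → krawSum n F w + F (suc n) * q) (kraw-vanish n (suc n) w (NP.n<1+n n) w≤n) ⟩
  krawSum n F w + F (suc n) * 0ℚ                     ≡⟨ solve 2 (λ a b → a :+ b :* con 0ℚ := a) refl (krawSum n F w) (F (suc n)) ⟩
  krawSum n F w                                      ∎
  where open ≡-Reasoning

krawSum-split : ∀ n w (F : ℕ → ℚ) (c : ℚ) (K′ : ℕ → ℚ) → w ℕ.≤ n → K′ 0 ≡ 1ℚ →
  (∀ k → K′ (suc k) ≡ kraw n (suc k) w + c * kraw n k w) →
  ∑< (suc (suc n)) (λ k → F k * K′ k) ≡ krawSum n F w + c * krawSum n (F ∘ suc) w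
krawSum-split n w F c K′ w≤n K′0 K′suc = begin
  ∑< (suc (suc n)) (λ k → F k * K′ k)
    ≡⟨ ∑<-shift (suc n) (λ k → F k * K′ k) ⟩
  F 0 * K′ 0 + ∑< (suc n) (λ k → F (suc k) * K′ (suc k))
    ≡⟨ cong₂ _+_ (cong (F 0 *_) K′0) (∑<-cong (suc n) (λ k _ → summand k)) ⟩
  F 0 * 1ℚ + ∑< (suc n) (λ k → F (suc k) * kraw n (suc k) w + c * (F (suc k) * kraw n k w))
    ≡⟨ cong (F 0 * 1ℚ +_) separate ⟩
  F 0 * 1ℚ + (∑< (suc n) (λ k → F (suc k) * kraw n (suc k) w) + c * krawSum n (F ∘ suc) w)
    ≡⟨ sym (QP.+-assoc (F 0 * 1ℚ) _ _) ⟩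
  (F 0 * 1ℚ + ∑< (suc n) (λ k → F (suc k) * kraw n (suc k) w)) + c * krawSum n (F ∘ suc) w
    ≡⟨ cong (_+ c * krawSum n (F ∘ suc) w) (sym (∑<-shift (suc n) (λ k → F k * kraw n k w))) ⟩
  ∑< (suc (suc n)) (λ k → F k * kraw n k w) + c * krawSum n (F ∘ suc) w
    ≡⟨ cong (_+ c * krawSum n (F ∘ suc) w) (krawSum-extend n F w w≤n) ⟩
  krawSum n F w + c * krawSum n (F ∘ suc) w ∎
  where
  open ≡-Reasoning
  separate : ∑< (suc n) (λ k → F (suc k) * kraw n (suc k) w + c * (F (suc k) * kraw n k w))
           ≡ ∑< (suc n) (λ k → F (suc k) * kraw n (suc k) w) + c * krawSum n (F ∘ suc) w
  separate = trans (∑ₗ-+ (upTo (suc n)) (λ k → F (suc k) * kraw n (suc k) w) (λ k → c * (F (suc k) * kraw n k w)))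
                   (cong (∑< (suc n) (λ k → F (suc k) * kraw n (suc k) w) +_) (∑ₗ-*ˡ (upTo (suc n)) c (λ k → F (suc k) * kraw n k w)))
  summand : ∀ k → F (suc k) * K′ (suc k) ≡ F (suc k) * kraw n (suc k) w + c * (F (suc k) * kraw n k w)
  summand k = trans (cong (F (suc k) *_) (K′suc k))
    (solve 4 (λ f a c b → f :* (a :+ c :* b) := f :* a :+ c :* (f :* b)) refl (F (suc k)) (kraw n (suc k) w) c (kraw n k w))

krawSum-suc : ∀ n F w → w ℕ.≤ n → krawSum (suc n) F w ≡ krawSum n F w + krawSum n (F ∘ suc) w
krawSum-suc n F w w≤n =
  trans (krawSum-split n w F 1ℚ (λ k → kraw (suc n) k w) w≤n refl
          (λ k → trans (kraw-suc n k w w≤n) (cong (kraw n (suc k) w +_) (sym (QP.*-identityˡ (kraw n k w))))))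
        (cong (krawSum n F w +_) (QP.*-identityˡ (krawSum n (F ∘ suc) w)))

krawSum-suc-suc : ∀ n F w → w ℕ.≤ n → krawSum (suc n) F (suc w) ≡ krawSum n F w - krawSum n (F ∘ suc) w
krawSum-suc-suc n F w w≤n =
  trans (krawSum-split n w F (- 1ℚ) (λ k → kraw (suc n) k (suc w)) w≤n refl
          (λ k → trans (kraw-suc-suc n k w) (cong (kraw n (suc k) w +_) (minus-one (kraw n k w)))))
        (cong (krawSum n F w +_) (sym (minus-one (krawSum n (F ∘ suc) w))))
  where
  minus-one : ∀ a → - a ≡ (- 1ℚ) * a
  minus-one = solve 1 (λ a → :- a := con (- 1ℚ) :* a) refl

wt : ∀ {n} → Vec Bool n → ℕ
wt []          = 0
wt (false ∷ u) = wt u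
wt (true ∷ u)  = suc (wt u)

zeros : ∀ n → Vec Bool n
zeros zero    = []
zeros (suc n) = false ∷ zeros n

_⊕_ : ∀ {n} → Vec Bool n → Vec Bool n → Vec Bool n
_⊕_ = zipWith _xor_

wt-≤ : ∀ {n} (u : Vec Bool n) → wt u ℕ.≤ n
wt-≤ []          = ℕ.z≤n
wt-≤ (false ∷ u) = NP.m≤n⇒m≤1+n (wt-≤ u)
wt-≤ (true ∷ u)  = ℕ.s≤s (wt-≤ u)

wt-zeros : ∀ n → wt (zeros n) ≡ 0
wt-zeros zero    = refl
wt-zeros (suc n) = wt-zeros n

wt-⊕ : ∀ {n} (x y : Vec Bool n) → wt (x ⊕ y) ≡ ham x y
wt-⊕ []          []          = refl
wt-⊕ (false ∷ x) (false ∷ y) = wt-⊕ x y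
wt-⊕ (false ∷ x) (true ∷ y)  = cong suc (wt-⊕ x y)
wt-⊕ (true ∷ x)  (false ∷ y) = cong suc (wt-⊕ x y)
wt-⊕ (true ∷ x)  (true ∷ y)  = wt-⊕ x y

ham-⊕ : ∀ {n} (x v : Vec Bool n) → ham x (x ⊕ v) ≡ wt v
ham-⊕ []          []          = refl
ham-⊕ (false ∷ x) (false ∷ v) = ham-⊕ x v
ham-⊕ (false ∷ x) (true ∷ v)  = cong suc (ham-⊕ x v)
ham-⊕ (true ∷ x)  (false ∷ v) = ham-⊕ x v
ham-⊕ (true ∷ x)  (true ∷ v)  = cong suc (ham-⊕ x v)

ham-≤ : ∀ {n} (x y : Vec Bool n) → ham x y ℕ.≤ n
ham-≤ x y = subst (ℕ._≤ _) (wt-⊕ x y) (wt-≤ (x ⊕ y))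

∑□-translate : ∀ n (x : Vec Bool n) (f : Vec Bool n → ℚ) → ∑□ n f ≡ ∑□ n (λ v → f (x ⊕ v))
∑□-translate zero    []      f = refl
∑□-translate (suc n) (a ∷ x) f = begin
  ∑□ (suc n) f                                                 ≡⟨ ∑□-suc n f ⟩
  ∑□ n (λ v → f (false ∷ v) + f (true ∷ v))                    ≡⟨ ∑□-translate n x _ ⟩
  ∑□ n (λ v → f (false ∷ (x ⊕ v)) + f (true ∷ (x ⊕ v)))        ≡⟨ ∑ₗ-cong (allVecs n) (λ v → head-swap a (x ⊕ v)) ⟩
  ∑□ n (λ v → f ((a xor false) ∷ (x ⊕ v)) + f ((a xor true) ∷ (x ⊕ v))) ≡⟨ sym (∑□-suc n (λ v → f ((a ∷ x) ⊕ v))) ⟩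
  ∑□ (suc n) (λ v → f ((a ∷ x) ⊕ v))                           ∎
  where
  open ≡-Reasoning
  head-swap : ∀ a w → f (false ∷ w) + f (true ∷ w) ≡ f ((a xor false) ∷ w) + f ((a xor true) ∷ w)
  head-swap false w = refl
  head-swap true  w = QP.+-comm (f (false ∷ w)) (f (true ∷ w))

-- The characters of the group {0,1}ⁿ = (ℤ/2)ⁿ:  χ z u = (-1)^{⟨z,u⟩}.
χ : ∀ {n} → Vec Bool n → Vec Bool n → ℚ
χ []          []          = 1ℚ
χ (false ∷ z) (_ ∷ u)     = χ z u
χ (true ∷ z)  (false ∷ u) = χ z u
χ (true ∷ z)  (true ∷ u)  = - χ z u

χ-sym : ∀ {n} (z u : Vec Bool n) → χ z u ≡ χ u z
χ-sym []          []          = refl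
χ-sym (false ∷ z) (false ∷ u) = χ-sym z u
χ-sym (false ∷ z) (true ∷ u)  = χ-sym z u
χ-sym (true ∷ z)  (false ∷ u) = χ-sym z u
χ-sym (true ∷ z)  (true ∷ u)  = cong -_ (χ-sym z u)

χ-zerosˡ : ∀ {n} (u : Vec Bool n) → χ (zeros n) u ≡ 1ℚ
χ-zerosˡ []      = refl
χ-zerosˡ (_ ∷ u) = χ-zerosˡ u

χ-sq : ∀ {n} (z u : Vec Bool n) → χ z u * χ z u ≡ 1ℚ
χ-sq []          []          = refl
χ-sq (false ∷ z) (_ ∷ u)     = χ-sq z u
χ-sq (true ∷ z)  (false ∷ u) = χ-sq z u
χ-sq (true ∷ z)  (true ∷ u)  = trans (solve 1 (λ a → (:- a) :* (:- a) := a :* a) refl (χ z u)) (χ-sq z u)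

χ-⊕ : ∀ {n} (z x y : Vec Bool n) → χ z (x ⊕ y) ≡ χ z x * χ z y
χ-⊕ []          []          []          = refl
χ-⊕ (false ∷ z) (_ ∷ x)     (_ ∷ y)     = χ-⊕ z x y
χ-⊕ (true ∷ z)  (false ∷ x) (false ∷ y) = χ-⊕ z x y
χ-⊕ (true ∷ z)  (false ∷ x) (true ∷ y)  = trans (cong -_ (χ-⊕ z x y)) (solve 2 (λ a b → :- (a :* b) := a :* (:- b)) refl (χ z x) (χ z y))
χ-⊕ (true ∷ z)  (true ∷ x)  (false ∷ y) = trans (cong -_ (χ-⊕ z x y)) (solve 2 (λ a b → :- (a :* b) := (:- a) :* b) refl (χ z x) (χ z y))
χ-⊕ (true ∷ z)  (true ∷ x)  (true ∷ y)  = trans (χ-⊕ z x y) (solve 2 (λ a b → a :* b := (:- a) :* (:- b)) refl (χ z x) (χ z y))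

-- Character sums of radial functions are Krawtchouk expansions:
--   Σ_z F(|z|) χ_z(x) = Σ_k F(k) K_k(|x|).
-- Splitting off the first coordinate of z gives the two recursions of krawSum.
radial-character-sum : ∀ n (x : Vec Bool n) (F : ℕ → ℚ) → ∑□ n (λ z → F (wt z) * χ z x) ≡ krawSum n F (wt x)
radial-character-sum zero    []      F = refl
radial-character-sum (suc n) (a ∷ x) F = trans (∑□-suc n (λ z → F (wt z) * χ z (a ∷ x))) (by-head a)
  where
  A = ∑□ n (λ z → F (wt z) * χ z x)
  B = ∑□ n (λ z → F (suc (wt z)) * χ z x)
  IH : A ≡ krawSum n F (wt x)
  IH = radial-character-sum n x F
  IH′ : B ≡ krawSum n (F ∘ suc) (wt x)
  IH′ = radial-character-sum n x (F ∘ suc)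
  by-head : ∀ a → ∑□ n (λ z → F (wt z) * χ z x + F (suc (wt z)) * χ (true ∷ z) (a ∷ x)) ≡ krawSum (suc n) F (wt (a ∷ x))
  by-head false = begin
    ∑□ n (λ z → F (wt z) * χ z x + F (suc (wt z)) * χ z x) ≡⟨ ∑ₗ-+ (allVecs n) _ _ ⟩
    A + B                                                   ≡⟨ cong₂ _+_ IH IH′ ⟩
    krawSum n F (wt x) + krawSum n (F ∘ suc) (wt x)         ≡⟨ sym (krawSum-suc n F (wt x) (wt-≤ x)) ⟩
    krawSum (suc n) F (wt x)                                ∎
    where open ≡-Reasoning
  by-head true = begin
    ∑□ n (λ z → F (wt z) * χ z x + F (suc (wt z)) * - χ z x)
      ≡⟨ ∑ₗ-cong (allVecs n) (λ z → cong (F (wt z) * χ z x +_) (sym (QP.neg-distribʳ-* (F (suc (wt z))) (χ z x)))) ⟩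
    ∑□ n (λ z → F (wt z) * χ z x - F (suc (wt z)) * χ z x)
      ≡⟨ ∑ₗ-- (allVecs n) _ _ ⟩
    A - B
      ≡⟨ cong₂ _-_ IH IH′ ⟩
    krawSum n F (wt x) - krawSum n (F ∘ suc) (wt x)
      ≡⟨ sym (krawSum-suc-suc n F (wt x) (wt-≤ x)) ⟩
    krawSum (suc n) F (suc (wt x)) ∎
    where open ≡-Reasoning

transform : ∀ {n} → (Vec Bool n → ℚ) → Vec Bool n → ℚ
transform {n} f z = ∑□ n (λ u → f u * χ z u)

transform-- : ∀ {n} (f g : Vec Bool n → ℚ) z → transform (λ u → f u - g u) z ≡ transform f z - transform g z
transform-- {n} f g z = trans (∑ₗ-cong (allVecs n) (λ u → solve 3 (λ a b c → (a :- b) :* c := a :* c :- b :* c) refl (f u) (g u) (χ z u)))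
  (∑ₗ-- (allVecs n) (λ u → f u * χ z u) (λ u → g u * χ z u))

transform-false : ∀ {n} (f : Vec Bool (suc n) → ℚ) z →
  transform f (false ∷ z) ≡ transform (f ∘ (false ∷_)) z + transform (f ∘ (true ∷_)) z
transform-false {n} f z = trans (∑□-suc n _) (∑ₗ-+ (allVecs n) _ _)

transform-true : ∀ {n} (f : Vec Bool (suc n) → ℚ) z →
  transform f (true ∷ z) ≡ transform (f ∘ (false ∷_)) z - transform (f ∘ (true ∷_)) z
transform-true {n} f z = trans (∑□-suc n _)
  (trans (∑ₗ-cong (allVecs n) (λ u → cong (f (false ∷ u) * χ z u +_) (sym (QP.neg-distribʳ-* (f (true ∷ u)) (χ z u)))))
         (∑ₗ-- (allVecs n) _ _))

parseval : ∀ n (f g : Vec Bool n → ℚ) → ∑□ n (λ u → f u * g u) ≡ pow2inv n * ∑□ n (λ z → transform f z * transform g z)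
parseval zero    f g = -- both sides are f [] · g [] (χ [] [] = 1, 2⁰ = 1)
  solve 2 (λ a b → a :* b :+ con 0ℚ := con 1ℚ :* ((a :* con 1ℚ :+ con 0ℚ) :* (b :* con 1ℚ :+ con 0ℚ) :+ con 0ℚ)) refl (f []) (g [])
parseval (suc n) f g = begin
  ∑□ (suc n) (λ u → f u * g u)
    ≡⟨ trans (∑□-suc n _) (∑ₗ-+ (allVecs n) _ _) ⟩
  ∑□ n (λ u → f₀ u * g₀ u) + ∑□ n (λ u → f₁ u * g₁ u)
    ≡⟨ cong₂ _+_ (parseval n f₀ g₀) (parseval n f₁ g₁) ⟩
  p * ∑□ n (λ z → F₀ z * G₀ z) + p * ∑□ n (λ z → F₁ z * G₁ z)
    ≡⟨ solve 3 (λ p a b → p :* a :+ p :* b := (con ½ :* p) :* ((con 1ℚ :+ con 1ℚ) :* (a :+ b))) refl p _ _ ⟩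
  pow2inv (suc n) * ((1ℚ + 1ℚ) * (∑□ n (λ z → F₀ z * G₀ z) + ∑□ n (λ z → F₁ z * G₁ z)))
    ≡⟨ cong (pow2inv (suc n) *_) (trans (cong ((1ℚ + 1ℚ) *_) (sym (∑ₗ-+ (allVecs n) _ _))) (sym (∑ₗ-*ˡ (allVecs n) (1ℚ + 1ℚ) _))) ⟩
  pow2inv (suc n) * ∑□ n (λ z → (1ℚ + 1ℚ) * (F₀ z * G₀ z + F₁ z * G₁ z))
    ≡⟨ cong (pow2inv (suc n) *_) (∑ₗ-cong (allVecs n) halves) ⟩
  pow2inv (suc n) * ∑□ n (λ z → transform f (false ∷ z) * transform g (false ∷ z) + transform f (true ∷ z) * transform g (true ∷ z))
    ≡⟨ cong (pow2inv (suc n) *_) (sym (∑□-suc n (λ z → transform f z * transform g z))) ⟩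
  pow2inv (suc n) * ∑□ (suc n) (λ z → transform f z * transform g z) ∎
  where
  open ≡-Reasoning
  p = pow2inv n
  f₀ f₁ g₀ g₁ : Vec Bool n → ℚ
  f₀ = f ∘ (false ∷_)
  f₁ = f ∘ (true ∷_)
  g₀ = g ∘ (false ∷_)
  g₁ = g ∘ (true ∷_)
  F₀ F₁ G₀ G₁ : Vec Bool n → ℚ
  F₀ = transform f₀
  F₁ = transform f₁
  G₀ = transform g₀
  G₁ = transform g₁
  halves : ∀ z → (1ℚ + 1ℚ) * (F₀ z * G₀ z + F₁ z * G₁ z)
               ≡ transform f (false ∷ z) * transform g (false ∷ z) + transform f (true ∷ z) * transform g (true ∷ z)
  halves z = sym (trans (cong₂ _+_ (cong₂ _*_ (transform-false f z) (transform-false g z))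
                                   (cong₂ _*_ (transform-true f z) (transform-true g z)))
    (solve 4 (λ a b c d → (a :+ b) :* (c :+ d) :+ (a :- b) :* (c :- d) := (con 1ℚ :+ con 1ℚ) :* (a :* c :+ b :* d)) refl
       (F₀ z) (F₁ z) (G₀ z) (G₁ z)))

transform-distance : ∀ n (g : ℕ → ℚ) (x z : Vec Bool n) →
  transform (λ u → g (ham x u)) z ≡ χ z x * krawSum n g (wt z)
transform-distance n g x z = begin
  ∑□ n (λ u → g (ham x u) * χ z u)                  ≡⟨ ∑□-translate n x _ ⟩
  ∑□ n (λ v → g (ham x (x ⊕ v)) * χ z (x ⊕ v))      ≡⟨ ∑ₗ-cong (allVecs n) summand ⟩
  ∑□ n (λ v → χ z x * (g (wt v) * χ v z))           ≡⟨ ∑ₗ-*ˡ (allVecs n) (χ z x) _ ⟩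
  χ z x * ∑□ n (λ v → g (wt v) * χ v z)             ≡⟨ cong (χ z x *_) (radial-character-sum n z g) ⟩
  χ z x * krawSum n g (wt z)                        ∎
  where
  open ≡-Reasoning
  summand : ∀ v → g (ham x (x ⊕ v)) * χ z (x ⊕ v) ≡ χ z x * (g (wt v) * χ v z)
  summand v = trans (cong₂ _*_ (cong g (ham-⊕ x v)) (trans (χ-⊕ z x v) (cong (χ z x *_) (χ-sym z v))))
    (solve 3 (λ a b c → a :* (b :* c) := b :* (a :* c)) refl (g (wt v)) (χ z x) (χ v z))

-- Indicator of the Hamming ball {u : d(x,u) < r}, the volume of such a ball, and
-- the partial sums Σ_{i<r} K_i^{(n)}(k), which are the transforms of ball indicators.
ball : ∀ {n} → ℕ → Vec Bool n → Vec Bool n → ℚ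
ball r x u = ind (ham x u <ᵇ r)

ballVolume : ℕ → ℕ → ℚ
ballVolume n r = ∑□ n (λ u → ind (wt u <ᵇ r))

ballSum : ℕ → ℕ → ℕ → ℚ
ballSum n k r = krawSum n (λ i → ind (i <ᵇ r)) k

ball-zeros : ∀ n r (u : Vec Bool n) → ball r (zeros n) u ≡ ind (wt u <ᵇ r)
ball-zeros n r u = cong (λ d → ind (d <ᵇ r)) (trans (sym (wt-⊕ (zeros n) u)) (cong wt (zeros-⊕ u)))
  where
  zeros-⊕ : ∀ {m} (v : Vec Bool m) → zeros m ⊕ v ≡ v
  zeros-⊕ []      = refl
  zeros-⊕ (b ∷ v) = cong (b ∷_) (zeros-⊕ v)

ballVolume-parseval : ∀ n r → pow2inv n * ∑□ n (λ z → ballSum n (wt z) r * ballSum n (wt z) r) ≡ ballVolume n r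
ballVolume-parseval n r = begin
  pow2inv n * ∑□ n (λ z → ballSum n (wt z) r * ballSum n (wt z) r)
    ≡⟨ cong (pow2inv n *_) (∑ₗ-cong (allVecs n) (λ z → cong (λ q → q * q) (sym (transform₀ z)))) ⟩
  pow2inv n * ∑□ n (λ z → transform (ball r (zeros n)) z * transform (ball r (zeros n)) z)
    ≡⟨ sym (parseval n (ball r (zeros n)) (ball r (zeros n))) ⟩
  ∑□ n (λ u → ball r (zeros n) u * ball r (zeros n) u)
    ≡⟨ ∑ₗ-cong (allVecs n) (λ u → trans (cong (λ q → q * q) (ball-zeros n r u)) (ind-idem (wt u <ᵇ r))) ⟩
  ballVolume n r ∎
  where
  open ≡-Reasoning
  transform₀ : ∀ z → transform (ball r (zeros n)) z ≡ ballSum n (wt z) r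
  transform₀ z = trans (transform-distance n (λ d → ind (d <ᵇ r)) (zeros n) z)
    (trans (cong (_* ballSum n (wt z) r) (trans (χ-sym z (zeros n)) (χ-zerosˡ z))) (QP.*-identityˡ _))

ballSum-weight0 : ∀ n r → ballSum n 0 r ≡ ballVolume n r
ballSum-weight0 n r = begin
  ballSum n 0 r                                             ≡⟨ cong (λ k → ballSum n k r) (sym (wt-zeros n)) ⟩
  ballSum n (wt (zeros n)) r                                ≡⟨ sym (radial-character-sum n (zeros n) (λ i → ind (i <ᵇ r))) ⟩
  ∑□ n (λ u → ind (wt u <ᵇ r) * χ u (zeros n))              ≡⟨ ∑ₗ-cong (allVecs n) (λ u → trans (cong (ind (wt u <ᵇ r) *_) (trans (χ-sym u (zeros n)) (χ-zerosˡ u))) (QP.*-identityʳ _)) ⟩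
  ballVolume n r                                            ∎
  where open ≡-Reasoning

ball-difference : ∀ n r (x y : Vec Bool n) →
  ∑□ n (λ u → (ball r x u - ball r y u) * (ball r x u - ball r y u))
  ≡ pow2inv n * ∑□ n (λ z → (ballSum n (wt z) r * ballSum n (wt z) r) * ((1ℚ + 1ℚ) * (1ℚ - χ z (x ⊕ y))))
ball-difference n r x y = trans (parseval n d d) (cong (pow2inv n *_) (∑ₗ-cong (allVecs n) pointwise))
  where
  below : ℕ → ℚ
  below i = ind (i <ᵇ r)
  d : Vec Bool n → ℚ
  d u = ball r x u - ball r y u
  pointwise : ∀ z → transform d z * transform d z ≡ (ballSum n (wt z) r * ballSum n (wt z) r) * ((1ℚ + 1ℚ) * (1ℚ - χ z (x ⊕ y)))
  pointwise z = begin
    transform d z * transform d z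
      ≡⟨ cong (λ q → q * q) (trans (transform-- (ball r x) (ball r y) z)
           (cong₂ _-_ (transform-distance n below x z) (transform-distance n below y z))) ⟩
    (a * β - b * β) * (a * β - b * β)
      ≡⟨ solve 3 (λ a b β → (a :* β :- b :* β) :* (a :* β :- b :* β)
                           := (β :* β) :* (a :* a :+ b :* b :- (con 1ℚ :+ con 1ℚ) :* (a :* b))) refl a b β ⟩
    (β * β) * (a * a + b * b - (1ℚ + 1ℚ) * (a * b))
      ≡⟨ cong (λ q → (β * β) * q) (cong₂ (λ s t → s + t - (1ℚ + 1ℚ) * (a * b)) (χ-sq z x) (χ-sq z y)) ⟩
    (β * β) * (1ℚ + 1ℚ - (1ℚ + 1ℚ) * (a * b))
      ≡⟨ cong (λ q → (β * β) * q) (solve 1 (λ c → con 1ℚ :+ con 1ℚ :- (con 1ℚ :+ con 1ℚ) :* c := (con 1ℚ :+ con 1ℚ) :* (con 1ℚ :- c)) refl (a * b)) ⟩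
    (β * β) * ((1ℚ + 1ℚ) * (1ℚ - a * b))
      ≡⟨ cong (λ q → (β * β) * ((1ℚ + 1ℚ) * (1ℚ - q))) (sym (χ-⊕ z x y)) ⟩
    (β * β) * ((1ℚ + 1ℚ) * (1ℚ - χ z (x ⊕ y))) ∎
    where
    open ≡-Reasoning
    a = χ z x
    b = χ z y
    β = ballSum n (wt z) r

ballSquares : ℕ → ℕ → ℚ
ballSquares n k = ∑< (suc n) (λ r → ballSum n k r * ballSum n k r)

∑<-truncate : ∀ n t (g : ℕ → ℚ) → t ℕ.≤ n → ∑< (suc n) (λ i → ind (i <ᵇ suc t) * g i) ≡ ∑< (suc t) g
∑<-truncate n zero g _ = begin
  ∑< (suc n) (λ i → ind (i <ᵇ 1) * g i)          ≡⟨ ∑<-shift n (λ i → ind (i <ᵇ 1) * g i) ⟩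
  1ℚ * g 0 + ∑< n (λ i → 0ℚ * g (suc i))         ≡⟨ cong₂ _+_ (QP.*-identityˡ (g 0)) (∑<-vanish n _ (λ i → QP.*-zeroˡ (g (suc i)))) ⟩
  g 0 + 0ℚ                                       ∎
  where open ≡-Reasoning
∑<-truncate (suc n) (suc t) g (ℕ.s≤s t≤n) = begin
  ∑< (suc (suc n)) (λ i → ind (i <ᵇ suc (suc t)) * g i)  ≡⟨ ∑<-shift (suc n) (λ i → ind (i <ᵇ suc (suc t)) * g i) ⟩
  1ℚ * g 0 + ∑< (suc n) (λ i → ind (i <ᵇ suc t) * g (suc i)) ≡⟨ cong₂ _+_ (QP.*-identityˡ (g 0)) (∑<-truncate n t (g ∘ suc) t≤n) ⟩
  g 0 + ∑< (suc t) (g ∘ suc)                              ≡⟨ sym (∑<-shift (suc t) g) ⟩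
  ∑< (suc (suc t)) g                                      ∎
  where open ≡-Reasoning

-- Σ_{i ≤ t} K_i^{(m+1)}(j+1) = K_t^{(m)}(j): a telescoping sum by kraw-suc-suc.
kraw-telescope : ∀ m j t → ∑< (suc t) (λ i → kraw (suc m) i (suc j)) ≡ kraw m t j
kraw-telescope m j zero    = refl
kraw-telescope m j (suc t) = begin
  ∑< (suc (suc t)) (λ i → kraw (suc m) i (suc j))
    ≡⟨ ∑<-snoc (suc t) (λ i → kraw (suc m) i (suc j)) ⟩
  ∑< (suc t) (λ i → kraw (suc m) i (suc j)) + kraw (suc m) (suc t) (suc j)
    ≡⟨ cong₂ _+_ (kraw-telescope m j t) (kraw-suc-suc m t j) ⟩
  kraw m t j + (kraw m (suc t) j - kraw m t j)
    ≡⟨ solve 2 (λ a b → a :+ (b :- a) := b) refl (kraw m t j) (kraw m (suc t) j) ⟩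
  kraw m (suc t) j ∎
  where open ≡-Reasoning

-- Hence the partial sums at positive weight are Krawtchouk values of order m:
--   H(m+1, j+1) = Σ_{t ≤ m} (K_t^{(m)}(j))².
ballSquares-suc : ∀ m j → ballSquares (suc m) (suc j) ≡ ∑< (suc m) (λ t → kraw m t j * kraw m t j)
ballSquares-suc m j = begin
  ∑< (suc (suc m)) (λ r → β r * β r)
    ≡⟨ ∑<-shift (suc m) (λ r → β r * β r) ⟩
  β 0 * β 0 + ∑< (suc m) (λ t → β (suc t) * β (suc t))
    ≡⟨ cong₂ _+_ (cong (λ q → q * q) β0) (∑<-cong (suc m) (λ t t<1+m → cong (λ q → q * q) (βsuc t (NP.<⇒≤pred t<1+m)))) ⟩
  0ℚ * 0ℚ + ∑< (suc m) (λ t → kraw m t j * kraw m t j)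
    ≡⟨ QP.+-identityˡ _ ⟩
  ∑< (suc m) (λ t → kraw m t j * kraw m t j) ∎
  where
  open ≡-Reasoning
  β : ℕ → ℚ
  β = ballSum (suc m) (suc j)
  β0 : β 0 ≡ 0ℚ
  β0 = ∑<-vanish (suc (suc m)) _ (λ i → QP.*-zeroˡ (kraw (suc m) i (suc j)))
  βsuc : ∀ t → t ℕ.≤ m → β (suc t) ≡ kraw m t j
  βsuc t t≤m = trans (∑<-truncate (suc m) t (λ i → kraw (suc m) i (suc j)) (NP.m≤n⇒m≤1+n t≤m)) (kraw-telescope m j t)

count-upto : ∀ b n → b ℕ.≤ n → ∑< (suc n) (λ r → 1ℚ - ind (b <ᵇ r)) ≡ toℚ (suc b)
count-upto zero    n       _           = trans (∑<-shift n (λ r → 1ℚ - ind (0 <ᵇ r)))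
  (cong ((1ℚ - 0ℚ) +_) (∑<-vanish n (λ r → 1ℚ - ind (0 <ᵇ suc r)) (λ _ → QP.+-inverseʳ 1ℚ)))
count-upto (suc b) (suc n) (ℕ.s≤s b≤n) = trans (∑<-shift (suc n) (λ r → 1ℚ - ind (suc b <ᵇ r)))
  (trans (cong (1ℚ +_) (count-upto b n b≤n)) (sym (toℚ-+ 1 (suc b))))

count-between : ∀ a b n → a ℕ.≤ n → b ℕ.≤ n → ∑< (suc n) (λ r → ind (a <ᵇ r) * (1ℚ - ind (b <ᵇ r))) ≡ toℚ (b ∸ a)
count-between zero zero n _ _ = ∑<-vanish (suc n) _ empty
  where
  empty : ∀ r → ind (0 <ᵇ r) * (1ℚ - ind (0 <ᵇ r)) ≡ 0ℚ
  empty zero    = refl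
  empty (suc r) = refl
count-between zero (suc b) (suc n) _ (ℕ.s≤s b≤n) = begin
  ∑< (suc (suc n)) (λ r → ind (0 <ᵇ r) * (1ℚ - ind (suc b <ᵇ r)))
    ≡⟨ ∑<-shift (suc n) (λ r → ind (0 <ᵇ r) * (1ℚ - ind (suc b <ᵇ r))) ⟩
  0ℚ * 1ℚ + ∑< (suc n) (λ r → 1ℚ * (1ℚ - ind (b <ᵇ r)))
    ≡⟨ trans (QP.+-identityˡ _) (∑<-cong (suc n) (λ r _ → QP.*-identityˡ (1ℚ - ind (b <ᵇ r)))) ⟩
  ∑< (suc n) (λ r → 1ℚ - ind (b <ᵇ r))
    ≡⟨ count-upto b n b≤n ⟩
  toℚ (suc b) ∎
  where open ≡-Reasoning
count-between (suc a) zero n _ _ = ∑<-vanish (suc n) _ empty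
  where
  empty : ∀ r → ind (suc a <ᵇ r) * (1ℚ - ind (0 <ᵇ r)) ≡ 0ℚ
  empty zero    = refl
  empty (suc r) = QP.*-zeroʳ (ind (a <ᵇ r))
count-between (suc a) (suc b) (suc n) (ℕ.s≤s a≤n) (ℕ.s≤s b≤n) =
  trans (∑<-shift (suc n) (λ r → ind (suc a <ᵇ r) * (1ℚ - ind (suc b <ᵇ r))))
        (trans (QP.+-identityˡ _) (count-between a b n a≤n b≤n))

∣-∣-layers : ∀ n a b → a ℕ.≤ n → b ℕ.≤ n →
  ∣ toℚ a - toℚ b ∣ ≡ ∑< (suc n) (λ r → (ind (a <ᵇ r) - ind (b <ᵇ r)) * (ind (a <ᵇ r) - ind (b <ᵇ r)))
∣-∣-layers n a b a≤n b≤n = begin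
  ∣ toℚ a - toℚ b ∣
    ≡⟨ ∣toℚ-toℚ∣ a b ⟩
  toℚ (b ∸ a) + toℚ (a ∸ b)
    ≡⟨ sym (cong₂ _+_ (count-between a b n a≤n b≤n) (count-between b a n b≤n a≤n)) ⟩
  ∑< (suc n) (λ r → p r * (1ℚ - q r)) + ∑< (suc n) (λ r → q r * (1ℚ - p r))
    ≡⟨ sym (∑ₗ-+ (upTo (suc n)) (λ r → p r * (1ℚ - q r)) (λ r → q r * (1ℚ - p r))) ⟩
  ∑< (suc n) (λ r → p r * (1ℚ - q r) + q r * (1ℚ - p r))
    ≡⟨ ∑<-cong (suc n) (λ r _ → square r) ⟩
  ∑< (suc n) (λ r → (p r - q r) * (p r - q r)) ∎
  where
  open ≡-Reasoning
  p q : ℕ → ℚ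
  p r = ind (a <ᵇ r)
  q r = ind (b <ᵇ r)
  -- (p - q)² = p(1 - q) + q(1 - p) for idempotent p, q.
  square : ∀ r → p r * (1ℚ - q r) + q r * (1ℚ - p r) ≡ (p r - q r) * (p r - q r)
  square r = begin
    p r * (1ℚ - q r) + q r * (1ℚ - p r)
      ≡⟨ solve 2 (λ x y → x :* (con 1ℚ :- y) :+ y :* (con 1ℚ :- x) := x :+ y :- (con 1ℚ :+ con 1ℚ) :* (x :* y)) refl (p r) (q r) ⟩
    p r + q r - (1ℚ + 1ℚ) * (p r * q r)
      ≡⟨ cong₂ (λ s t → s + t - (1ℚ + 1ℚ) * (p r * q r)) (sym (ind-idem (a <ᵇ r))) (sym (ind-idem (b <ᵇ r))) ⟩
    p r * p r + q r * q r - (1ℚ + 1ℚ) * (p r * q r)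
      ≡⟨ solve 2 (λ x y → x :* x :+ y :* y :- (con 1ℚ :+ con 1ℚ) :* (x :* y) := (x :- y) :* (x :- y)) refl (p r) (q r) ⟩
    (p r - q r) * (p r - q r) ∎

∑□² : (n : ℕ) → (Vec Bool n → Vec Bool n → ℚ) → ℚ
∑□² n f = ∑□ n (λ u → ∑□ n (f u))

∑□²-cong : ∀ n {f g : Vec Bool n → Vec Bool n → ℚ} → (∀ u v → f u v ≡ g u v) → ∑□² n f ≡ ∑□² n g
∑□²-cong n e = ∑ₗ-cong (allVecs n) (λ u → ∑ₗ-cong (allVecs n) (e u))

∑□²-+ : ∀ n (f g : Vec Bool n → Vec Bool n → ℚ) → ∑□² n (λ u v → f u v + g u v) ≡ ∑□² n f + ∑□² n g
∑□²-+ n f g = trans (∑ₗ-cong (allVecs n) (λ u → ∑ₗ-+ (allVecs n) (f u) (g u)))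
                    (∑ₗ-+ (allVecs n) (λ u → ∑□ n (f u)) (λ u → ∑□ n (g u)))

∑□²-*ˡ : ∀ n c (f : Vec Bool n → Vec Bool n → ℚ) → ∑□² n (λ u v → c * f u v) ≡ c * ∑□² n f
∑□²-*ˡ n c f = trans (∑ₗ-cong (allVecs n) (λ u → ∑ₗ-*ˡ (allVecs n) c (f u))) (∑ₗ-*ˡ (allVecs n) c (λ u → ∑□ n (f u)))

∑□²-vanish : ∀ n → ∑□² n (λ _ _ → 0ℚ) ≡ 0ℚ
∑□²-vanish n = trans (∑ₗ-cong (allVecs n) (λ _ → ∑ₗ-0 (allVecs n))) (∑ₗ-0 (allVecs n))

∑□²-suc : ∀ n (f : Vec Bool (suc n) → Vec Bool (suc n) → ℚ) →
  ∑□² (suc n) f ≡ ∑□² n (λ u v → (f (false ∷ u) (false ∷ v) + f (false ∷ u) (true ∷ v)) + (f (true ∷ u) (false ∷ v) + f (true ∷ u) (true ∷ v)))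
∑□²-suc n f = trans (∑□-suc n (λ u → ∑□ (suc n) (f u)))
  (∑ₗ-cong (allVecs n) (λ u → trans (cong₂ _+_ (∑□-suc n (f (false ∷ u))) (∑□-suc n (f (true ∷ u))))
                                     (sym (∑ₗ-+ (allVecs n) _ _))))

zeroCount : ∀ {n} → Vec Bool n → ℕ
zeroCount []          = 0
zeroCount (false ∷ u) = suc (zeroCount u)
zeroCount (true ∷ u)  = zeroCount u

wt+zeroCount : ∀ {n} (u : Vec Bool n) → wt u ℕ.+ zeroCount u ≡ n
wt+zeroCount []          = refl
wt+zeroCount (false ∷ u) = trans (NP.+-suc (wt u) (zeroCount u)) (cong suc (wt+zeroCount u))
wt+zeroCount (true ∷ u)  = cong suc (wt+zeroCount u)

-- pairs n s j = #{(u, v) : s + |u| + zeroCount v = j}.  Since |u| + zeroCount v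
-- is the weight of the concatenation of u and the complement of v in {0,1}^{2n},
-- pairs n 0 j = C(2n, j).
pairs : ℕ → ℕ → ℕ → ℚ
pairs n s j = ∑□² n (λ u v → ind (s ℕ.+ (wt u ℕ.+ zeroCount v) ≡ᵇ j))

pairs-rec : ∀ n j → pairs (suc n) 0 j ≡ (pairs n 0 j + (pairs n 1 j + pairs n 1 j)) + pairs n 2 j
pairs-rec n j = begin
  pairs (suc n) 0 j
    ≡⟨ ∑□²-suc n _ ⟩
  ∑□² n (λ u v → (I (wt u ℕ.+ suc (zeroCount v)) + I (wt u ℕ.+ zeroCount v)) + (I (suc (wt u ℕ.+ suc (zeroCount v))) + I (suc (wt u ℕ.+ zeroCount v))))
    ≡⟨ ∑□²-cong n (λ u v → regroup (wt u) (zeroCount v)) ⟩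
  ∑□² n (λ u v → (I (wt u ℕ.+ zeroCount v) + (I (suc (wt u ℕ.+ zeroCount v)) + I (suc (wt u ℕ.+ zeroCount v)))) + I (suc (suc (wt u ℕ.+ zeroCount v))))
    ≡⟨ trans (∑□²-+ n _ _) (cong (_+ pairs n 2 j) (trans (∑□²-+ n _ _) (cong (pairs n 0 j +_) (∑□²-+ n _ _)))) ⟩
  (pairs n 0 j + (pairs n 1 j + pairs n 1 j)) + pairs n 2 j ∎
  where
  open ≡-Reasoning
  I : ℕ → ℚ
  I m = ind (m ≡ᵇ j)
  regroup : ∀ a f → (I (a ℕ.+ suc f) + I (a ℕ.+ f)) + (I (suc (a ℕ.+ suc f)) + I (suc (a ℕ.+ f)))
                  ≡ (I (a ℕ.+ f) + (I (suc (a ℕ.+ f)) + I (suc (a ℕ.+ f)))) + I (suc (suc (a ℕ.+ f)))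
  regroup a f rewrite NP.+-suc a f =
    solve 3 (λ x y z → (y :+ x) :+ (z :+ y) := (x :+ (y :+ y)) :+ z) refl (I (a ℕ.+ f)) (I (suc (a ℕ.+ f))) (I (suc (suc (a ℕ.+ f))))

pairs-binomial : ∀ n j → pairs n 0 j ≡ toℚ ((n ℕ.+ n) C j)
pairs-binomial zero    zero    = refl
pairs-binomial zero    (suc j) = refl
pairs-binomial (suc n) j = trans (pairs-rec n j) (trans (by-cases j) (cong (λ m → toℚ (m C j)) (sym 2+N≡[n+1]+[n+1])))
  where
  N = n ℕ.+ n
  2+N≡[n+1]+[n+1] : suc n ℕ.+ suc n ≡ suc (suc N)
  2+N≡[n+1]+[n+1] = cong suc (NP.+-suc n n)
  out-of-range : ∀ s → pairs n (suc s) 0 ≡ 0ℚ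
  out-of-range s = ∑□²-vanish n
  toℚ-sum : ∀ a b c → toℚ ((a ℕ.+ (b ℕ.+ b)) ℕ.+ c) ≡ (toℚ a + (toℚ b + toℚ b)) + toℚ c
  toℚ-sum a b c = trans (toℚ-+ (a ℕ.+ (b ℕ.+ b)) c) (cong (_+ toℚ c) (trans (toℚ-+ a (b ℕ.+ b)) (cong (toℚ a +_) (toℚ-+ b b))))
  by-cases : ∀ j → (pairs n 0 j + (pairs n 1 j + pairs n 1 j)) + pairs n 2 j ≡ toℚ (suc (suc N) C j)
  by-cases zero = begin
    (pairs n 0 0 + (pairs n 1 0 + pairs n 1 0)) + pairs n 2 0 ≡⟨ cong₂ (λ p q → (p + (q + q)) + q) (pairs-binomial n 0) (out-of-range 0) ⟩
    (toℚ (N C 0) + (0ℚ + 0ℚ)) + 0ℚ                        ≡⟨ refl ⟩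
    toℚ (suc (suc N) C 0) ∎
    where open ≡-Reasoning
  by-cases (suc zero) = begin
    (pairs n 0 1 + (pairs n 0 0 + pairs n 0 0)) + pairs n 1 0 ≡⟨ cong₂ _+_ (cong₂ (λ p q → p + (q + q)) (pairs-binomial n 1) (pairs-binomial n 0)) (out-of-range 0) ⟩
    (toℚ (N C 1) + (toℚ (N C 0) + toℚ (N C 0))) + toℚ 0      ≡⟨ sym (toℚ-sum (N C 1) (N C 0) 0) ⟩
    toℚ ((N C 1 ℕ.+ (N C 0 ℕ.+ N C 0)) ℕ.+ 0)                ≡⟨ cong toℚ (sym (pascal²-1 N)) ⟩
    toℚ (suc (suc N) C 1) ∎
    where open ≡-Reasoning
  by-cases (suc (suc j)) = begin
    (pairs n 0 (2 ℕ.+ j) + (pairs n 0 (suc j) + pairs n 0 (suc j))) + pairs n 0 j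
      ≡⟨ cong₂ _+_ (cong₂ (λ p q → p + (q + q)) (pairs-binomial n (2 ℕ.+ j)) (pairs-binomial n (suc j))) (pairs-binomial n j) ⟩
    (toℚ (N C suc (suc j)) + (toℚ (N C suc j) + toℚ (N C suc j))) + toℚ (N C j)
      ≡⟨ sym (toℚ-sum (N C suc (suc j)) (N C suc j) (N C j)) ⟩
    toℚ ((N C suc (suc j) ℕ.+ (N C suc j ℕ.+ N C suc j)) ℕ.+ N C j)
      ≡⟨ cong toℚ (sym (pascal² N j)) ⟩
    toℚ (suc (suc N) C suc (suc j)) ∎
    where open ≡-Reasoning

excess : ℕ → ℚ
excess n = ∑□² n (λ u v → toℚ (wt v ∸ wt u))

∸-neighbours : ∀ a b → toℚ (suc b ∸ a) + toℚ (b ∸ suc a) ≡ (toℚ (b ∸ a) + toℚ (b ∸ a)) + ind (a ≡ᵇ b)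
∸-neighbours zero    zero    = refl
∸-neighbours zero    (suc b) = begin
  toℚ (2 ℕ.+ b) + toℚ b                      ≡⟨ cong (_+ toℚ b) (toℚ-+ 1 (suc b)) ⟩
  (1ℚ + toℚ (1 ℕ.+ b)) + toℚ b               ≡⟨ cong (λ q → (1ℚ + q) + toℚ b) (toℚ-+ 1 b) ⟩
  (1ℚ + (1ℚ + toℚ b)) + toℚ b                ≡⟨ solve 1 (λ x → (con 1ℚ :+ (con 1ℚ :+ x)) :+ x := ((con 1ℚ :+ x) :+ (con 1ℚ :+ x)) :+ con 0ℚ) refl (toℚ b) ⟩
  ((1ℚ + toℚ b) + (1ℚ + toℚ b)) + 0ℚ         ≡⟨ cong (λ q → (q + q) + 0ℚ) (sym (toℚ-+ 1 b)) ⟩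
  (toℚ (suc b) + toℚ (suc b)) + 0ℚ           ∎
  where open ≡-Reasoning
∸-neighbours (suc a) zero    = cong (λ d → toℚ d + toℚ 0) (NP.0∸n≡0 a)
∸-neighbours (suc a) (suc b) = ∸-neighbours a b

≡ᵇ-+ : ∀ a b c → (a ℕ.+ c ≡ᵇ b ℕ.+ c) ≡ (a ≡ᵇ b)
≡ᵇ-+ a b zero    = cong₂ _≡ᵇ_ (NP.+-identityʳ a) (NP.+-identityʳ b)
≡ᵇ-+ a b (suc c) = trans (cong₂ _≡ᵇ_ (NP.+-suc a c) (NP.+-suc b c)) (≡ᵇ-+ a b c)

-- Splitting off the first coordinates: excess(n+1) = 4 excess(n) + #{|u| = |v|}.
excess-rec : ∀ n → excess (suc n) ≡ toℚ 4 * excess n + pairs n 0 n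
excess-rec n = begin
  excess (suc n)
    ≡⟨ ∑□²-suc n (λ u v → toℚ (wt v ∸ wt u)) ⟩
  ∑□² n (λ u v → (toℚ (wt v ∸ wt u) + toℚ (suc (wt v) ∸ wt u)) + (toℚ (wt v ∸ suc (wt u)) + toℚ (wt v ∸ wt u)))
    ≡⟨ ∑□²-cong n (λ u v → pointwise (wt u) (wt v) (zeroCount v) (wt+zeroCount v)) ⟩
  ∑□² n (λ u v → toℚ 4 * toℚ (wt v ∸ wt u) + ind (wt u ℕ.+ zeroCount v ≡ᵇ n))
    ≡⟨ trans (∑□²-+ n _ _) (cong (_+ pairs n 0 n) (∑□²-*ˡ n (toℚ 4) _)) ⟩
  toℚ 4 * excess n + pairs n 0 n ∎
  where
  open ≡-Reasoning
  pointwise : ∀ a b f → b ℕ.+ f ≡ n →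
    (toℚ (b ∸ a) + toℚ (suc b ∸ a)) + (toℚ (b ∸ suc a) + toℚ (b ∸ a)) ≡ toℚ 4 * toℚ (b ∸ a) + ind (a ℕ.+ f ≡ᵇ n)
  pointwise a b f b+f≡n = begin
    (X + toℚ (suc b ∸ a)) + (toℚ (b ∸ suc a) + X)
      ≡⟨ solve 3 (λ X Y Z → (X :+ Y) :+ (Z :+ X) := (X :+ X) :+ (Y :+ Z)) refl X (toℚ (suc b ∸ a)) (toℚ (b ∸ suc a)) ⟩
    (X + X) + (toℚ (suc b ∸ a) + toℚ (b ∸ suc a))
      ≡⟨ cong ((X + X) +_) (∸-neighbours a b) ⟩
    (X + X) + ((X + X) + ind (a ≡ᵇ b))
      ≡⟨ solve 2 (λ X I → (X :+ X) :+ ((X :+ X) :+ I) := con (toℚ 4) :* X :+ I) refl X (ind (a ≡ᵇ b)) ⟩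
    toℚ 4 * X + ind (a ≡ᵇ b)
      ≡⟨ cong (λ t → toℚ 4 * X + ind t) (trans (sym (≡ᵇ-+ a b f)) (cong (a ℕ.+ f ≡ᵇ_) b+f≡n)) ⟩
    toℚ 4 * X + ind (a ℕ.+ f ≡ᵇ n) ∎
    where X = toℚ (b ∸ a)

excess-closed : ∀ n → excess n + excess n ≡ toℚ (n ℕ.* ((2 ℕ.* n) C n))
excess-closed zero    = refl
excess-closed (suc n) = begin
  excess (suc n) + excess (suc n)
    ≡⟨ cong (λ q → q + q) (excess-rec n) ⟩
  (toℚ 4 * excess n + E) + (toℚ 4 * excess n + E)
    ≡⟨ solve 3 (λ c p e → (c :* p :+ e) :+ (c :* p :+ e) := c :* (p :+ p) :+ (e :+ e)) refl (toℚ 4) (excess n) E ⟩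
  toℚ 4 * (excess n + excess n) + (E + E)
    ≡⟨ cong₂ (λ p q → toℚ 4 * p + (q + q)) (excess-closed n) (trans (pairs-binomial n n) (cong (λ m → toℚ (m C n)) n+n≡2n)) ⟩
  toℚ 4 * toℚ (n ℕ.* c) + (toℚ c + toℚ c)
    ≡⟨ cong₂ _+_ (sym (toℚ-* 4 (n ℕ.* c))) (sym (toℚ-+ c c)) ⟩
  toℚ (4 ℕ.* (n ℕ.* c)) + toℚ (c ℕ.+ c)
    ≡⟨ sym (toℚ-+ (4 ℕ.* (n ℕ.* c)) (c ℕ.+ c)) ⟩
  toℚ (4 ℕ.* (n ℕ.* c) ℕ.+ (c ℕ.+ c))
    ≡⟨ cong (λ q → toℚ (4 ℕ.* (n ℕ.* c) ℕ.+ q)) (cong (c ℕ.+_) (sym (NP.+-identityʳ c))) ⟩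
  toℚ (4 ℕ.* (n ℕ.* c) ℕ.+ 2 ℕ.* c)
    ≡⟨ cong toℚ (sym (central n)) ⟩
  toℚ (suc n ℕ.* ((2 ℕ.* suc n) C suc n)) ∎
  where
  open ≡-Reasoning
  c = (2 ℕ.* n) C n
  E = pairs n 0 n
  n+n≡2n : n ℕ.+ n ≡ 2 ℕ.* n
  n+n≡2n = cong (n ℕ.+_) (sym (NP.+-identityʳ n))

cubeSize : ℕ → ℚ
cubeSize n = ∑□ n (λ _ → 1ℚ)

pow2inv-cubeSize : ∀ n → pow2inv n * cubeSize n ≡ 1ℚ
pow2inv-cubeSize zero    = refl
pow2inv-cubeSize (suc n) = begin
  pow2inv (suc n) * cubeSize (suc n)              ≡⟨ cong (pow2inv (suc n) *_) (trans (∑□-suc n (λ _ → 1ℚ)) (∑ₗ-*ʳ (allVecs n) (1ℚ + 1ℚ) (λ _ → 1ℚ))) ⟩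
  (½ * pow2inv n) * (cubeSize n * (1ℚ + 1ℚ))      ≡⟨ solve 2 (λ p c → (con ½ :* p) :* (c :* (con 1ℚ :+ con 1ℚ)) := p :* c) refl (pow2inv n) (cubeSize n) ⟩
  pow2inv n * cubeSize n                          ≡⟨ pow2inv-cubeSize n ⟩
  1ℚ                                              ∎
  where open ≡-Reasoning

-- Σ_{r ≤ n} V(n, r) (2ⁿ - V(n, r)) counts the pairs (u, v, r) with |u| < r ≤ |v|.
ballVolume-complements : ∀ n → ∑< (suc n) (λ r → ballVolume n r * (cubeSize n - ballVolume n r)) ≡ excess n
ballVolume-complements n = begin
  ∑< (suc n) (λ r → ballVolume n r * (cubeSize n - ballVolume n r))
    ≡⟨ ∑<-cong (suc n) (λ r _ → product r) ⟩
  ∑< (suc n) (λ r → ∑□² n (λ u v → ind (wt u <ᵇ r) * (1ℚ - ind (wt v <ᵇ r))))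
    ≡⟨ ∑ₗ-swap (upTo (suc n)) (allVecs n) _ ⟩
  ∑□ n (λ u → ∑< (suc n) (λ r → ∑□ n (λ v → ind (wt u <ᵇ r) * (1ℚ - ind (wt v <ᵇ r)))))
    ≡⟨ ∑ₗ-cong (allVecs n) (λ u → ∑ₗ-swap (upTo (suc n)) (allVecs n) _) ⟩
  ∑□² n (λ u v → ∑< (suc n) (λ r → ind (wt u <ᵇ r) * (1ℚ - ind (wt v <ᵇ r))))
    ≡⟨ ∑□²-cong n (λ u v → count-between (wt u) (wt v) n (wt-≤ u) (wt-≤ v)) ⟩
  excess n ∎
  where
  open ≡-Reasoning
  product : ∀ r → ballVolume n r * (cubeSize n - ballVolume n r) ≡ ∑□² n (λ u v → ind (wt u <ᵇ r) * (1ℚ - ind (wt v <ᵇ r)))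
  product r = begin
    ballVolume n r * (cubeSize n - ballVolume n r)
      ≡⟨ cong (ballVolume n r *_) (sym (∑ₗ-- (allVecs n) (λ _ → 1ℚ) (λ v → ind (wt v <ᵇ r)))) ⟩
    ballVolume n r * W
      ≡⟨ sym (∑ₗ-*ʳ (allVecs n) W (λ u → ind (wt u <ᵇ r))) ⟩
    ∑□ n (λ u → ind (wt u <ᵇ r) * W)
      ≡⟨ ∑ₗ-cong (allVecs n) (λ u → sym (∑ₗ-*ˡ (allVecs n) (ind (wt u <ᵇ r)) (λ v → 1ℚ - ind (wt v <ᵇ r)))) ⟩
    ∑□² n (λ u v → ind (wt u <ᵇ r) * (1ℚ - ind (wt v <ᵇ r))) ∎
    where W = ∑□ n (λ v → 1ℚ - ind (wt v <ᵇ r))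

constant-coefficient : ∀ n → ∑< (suc n) (ballVolume n) - pow2inv n * ∑< (suc n) (λ r → ballVolume n r * ballVolume n r) ≡ lamHat n 0
constant-coefficient n = begin
  ∑V - p * ∑V²
    ≡⟨ cong (_- p * ∑V²) (trans (sym (QP.*-identityˡ ∑V)) (cong (_* ∑V) (sym (pow2inv-cubeSize n)))) ⟩
  (p * N) * ∑V - p * ∑V²
    ≡⟨ solve 4 (λ p N a b → (p :* N) :* a :- p :* b := p :* (N :* a :- b)) refl p N ∑V ∑V² ⟩
  p * (N * ∑V - ∑V²)
    ≡⟨ cong (λ q → p * (q - ∑V²)) (sym (∑ₗ-*ˡ (upTo (suc n)) N (ballVolume n))) ⟩
  p * (∑< (suc n) (λ r → N * V r) - ∑V²)
    ≡⟨ cong (p *_) (sym (∑ₗ-- (upTo (suc n)) (λ r → N * V r) (λ r → V r * V r))) ⟩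
  p * ∑< (suc n) (λ r → N * V r - V r * V r)
    ≡⟨ cong (p *_) (∑<-cong (suc n) (λ r _ → solve 2 (λ N v → N :* v :- v :* v := v :* (N :- v)) refl N (V r))) ⟩
  p * ∑< (suc n) (λ r → V r * (N - V r))
    ≡⟨ cong (p *_) (ballVolume-complements n) ⟩
  p * excess n
    ≡⟨ solve 2 (λ p x → p :* x := (x :+ x) :* (con ½ :* p)) refl p (excess n) ⟩
  (excess n + excess n) * (½ * p)
    ≡⟨ cong (_* (½ * p)) (excess-closed n) ⟩
  lamHat n 0 ∎
  where
  open ≡-Reasoning
  p = pow2inv n
  N = cubeSize n
  V = ballVolume n
  ∑V = ∑< (suc n) V
  ∑V² = ∑< (suc n) (λ r → V r * V r)

positive-coefficient : ∀ n k → k ℕ.< n → lamHat n (suc k) ≡ - (pow2inv n * ballSquares n (suc k))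
positive-coefficient (suc m) k _ = cong (λ q → - (pow2inv (suc m) * q)) (sym (ballSquares-suc m k))

lam-fourier : ∀ n (x y : Vec Bool n) → lam x y ≡ pow2inv n * ∑□ n (λ z → ballSquares n (wt z) * (1ℚ - χ z (x ⊕ y)))
lam-fourier n x y = begin
  lam x y
    ≡⟨ cong (½ *_) (∑ₗ-cong (allVecs n) (λ u → ∣-∣-layers n (ham x u) (ham y u) (ham-≤ x u) (ham-≤ y u))) ⟩
  ½ * ∑□ n (λ u → ∑< (suc n) (λ r → D r u * D r u))
    ≡⟨ cong (½ *_) (∑ₗ-swap (allVecs n) (upTo (suc n)) (λ u r → D r u * D r u)) ⟩
  ½ * ∑< (suc n) (λ r → ∑□ n (λ u → D r u * D r u))
    ≡⟨ cong (½ *_) (∑<-cong (suc n) (λ r _ → trans (ball-difference n r x y) (cong (p *_) (pull-two r)))) ⟩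
  ½ * ∑< (suc n) (λ r → p * ((1ℚ + 1ℚ) * A r))
    ≡⟨ cong (½ *_) (trans (∑ₗ-*ˡ (upTo (suc n)) p _) (cong (p *_) (∑ₗ-*ˡ (upTo (suc n)) (1ℚ + 1ℚ) A))) ⟩
  ½ * (p * ((1ℚ + 1ℚ) * ∑< (suc n) A))
    ≡⟨ solve 2 (λ p a → con ½ :* (p :* ((con 1ℚ :+ con 1ℚ) :* a)) := p :* a) refl p (∑< (suc n) A) ⟩
  p * ∑< (suc n) A
    ≡⟨ cong (p *_) (∑ₗ-swap (upTo (suc n)) (allVecs n) (λ r z → β r z * β r z * (1ℚ - c z))) ⟩
  p * ∑□ n (λ z → ∑< (suc n) (λ r → β r z * β r z * (1ℚ - c z)))
    ≡⟨ cong (p *_) (∑ₗ-cong (allVecs n) (λ z → ∑ₗ-*ʳ (upTo (suc n)) (1ℚ - c z) (λ r → β r z * β r z))) ⟩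
  p * ∑□ n (λ z → ballSquares n (wt z) * (1ℚ - c z)) ∎
  where
  open ≡-Reasoning
  p = pow2inv n
  D : ℕ → Vec Bool n → ℚ
  D r u = ball r x u - ball r y u
  c : Vec Bool n → ℚ
  c z = χ z (x ⊕ y)
  β : ℕ → Vec Bool n → ℚ
  β r z = ballSum n (wt z) r
  A : ℕ → ℚ
  A r = ∑□ n (λ z → β r z * β r z * (1ℚ - c z))
  pull-two : ∀ r → ∑□ n (λ z → (β r z * β r z) * ((1ℚ + 1ℚ) * (1ℚ - c z))) ≡ (1ℚ + 1ℚ) * A r
  pull-two r = trans (∑ₗ-cong (allVecs n) (λ z → solve 2 (λ b d → b :* ((con 1ℚ :+ con 1ℚ) :* d) := (con 1ℚ :+ con 1ℚ) :* (b :* d)) refl (β r z * β r z) (1ℚ - c z)))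
                     (∑ₗ-*ˡ (allVecs n) (1ℚ + 1ℚ) (λ z → β r z * β r z * (1ℚ - c z)))

-- Evaluating both character sums of lam-fourier:
--   λ(x, y) = Σ_r V(n, r) - 2⁻ⁿ Σ_k H(n, k) K_k(d(x, y)).
lam-krawtchouk : ∀ n (x y : Vec Bool n) → lam x y ≡ ∑< (suc n) (ballVolume n) - pow2inv n * krawSum n (ballSquares n) (ham x y)
lam-krawtchouk n x y = begin
  lam x y
    ≡⟨ lam-fourier n x y ⟩
  p * ∑□ n (λ z → H (wt z) * (1ℚ - c z))
    ≡⟨ cong (p *_) (trans (∑ₗ-cong (allVecs n) (λ z → solve 2 (λ h c → h :* (con 1ℚ :- c) := h :- h :* c) refl (H (wt z)) (c z)))
                          (∑ₗ-- (allVecs n) (λ z → H (wt z)) (λ z → H (wt z) * c z))) ⟩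
  p * (∑□ n (λ z → H (wt z)) - ∑□ n (λ z → H (wt z) * c z))
    ≡⟨ cong (λ t → p * (∑□ n (λ z → H (wt z)) - t)) (trans (radial-character-sum n (x ⊕ y) H) (cong (krawSum n H) (wt-⊕ x y))) ⟩
  p * (∑□ n (λ z → H (wt z)) - krawSum n H (ham x y))
    ≡⟨ trans (QP.*-distribˡ-+ p _ _) (cong (p * ∑□ n (λ z → H (wt z)) +_) (sym (QP.neg-distribʳ-* p _))) ⟩
  p * ∑□ n (λ z → H (wt z)) - p * krawSum n H (ham x y)
    ≡⟨ cong (_- p * krawSum n H (ham x y)) volumes ⟩
  ∑< (suc n) (ballVolume n) - p * krawSum n H (ham x y) ∎
  where
  open ≡-Reasoning
  p = pow2inv n
  H = ballSquares n
  c : Vec Bool n → ℚ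
  c z = χ z (x ⊕ y)
  -- 2⁻ⁿ Σ_z H(n, |z|) = Σ_r V(n, r), by Parseval for each ball about 0.
  volumes : p * ∑□ n (λ z → H (wt z)) ≡ ∑< (suc n) (ballVolume n)
  volumes = begin
    p * ∑□ n (λ z → H (wt z))
      ≡⟨ cong (p *_) (∑ₗ-swap (allVecs n) (upTo (suc n)) (λ z r → ballSum n (wt z) r * ballSum n (wt z) r)) ⟩
    p * ∑< (suc n) (λ r → ∑□ n (λ z → ballSum n (wt z) r * ballSum n (wt z) r))
      ≡⟨ sym (∑ₗ-*ˡ (upTo (suc n)) p _) ⟩
    ∑< (suc n) (λ r → p * ∑□ n (λ z → ballSum n (wt z) r * ballSum n (wt z) r))
      ≡⟨ ∑<-cong (suc n) (λ r _ → ballVolume-parseval n r) ⟩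
    ∑< (suc n) (ballVolume n) ∎

lam-expansion : ∀ n (x y : Vec Bool n) → lam x y ≡ sumTo n (λ k → lamHat n k * kraw n k (ham x y))
lam-expansion n x y = begin
  lam x y
    ≡⟨ lam-krawtchouk n x y ⟩
  ∑V - p * krawSum n H w
    ≡⟨ cong (λ q → ∑V - p * q) (∑<-shift n (λ k → H k * kraw n k w)) ⟩
  ∑V - p * (H 0 * 1ℚ + S)
    ≡⟨ cong (λ q → ∑V - p * (q * 1ℚ + S)) (∑<-cong (suc n) (λ r _ → cong (λ q → q * q) (ballSum-weight0 n r))) ⟩
  ∑V - p * (∑V² * 1ℚ + S)
    ≡⟨ solve 4 (λ v p h s → v :- p :* (h :* con 1ℚ :+ s) := (v :- p :* h) :* con 1ℚ :+ (:- (p :* s))) refl ∑V p ∑V² S ⟩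
  (∑V - p * ∑V²) * 1ℚ + - (p * S)
    ≡⟨ cong₂ (λ a b → a * 1ℚ + b) (constant-coefficient n) (sym higher) ⟩
  lamHat n 0 * 1ℚ + ∑< n (λ k → lamHat n (suc k) * kraw n (suc k) w)
    ≡⟨ sym (∑<-shift n (λ k → lamHat n k * kraw n k w)) ⟩
  sumTo n (λ k → lamHat n k * kraw n k w) ∎
  where
  open ≡-Reasoning
  p = pow2inv n
  H = ballSquares n
  w = ham x y
  ∑V = ∑< (suc n) (ballVolume n)
  ∑V² = ∑< (suc n) (λ r → ballVolume n r * ballVolume n r)
  S = ∑< n (λ k → H (suc k) * kraw n (suc k) w)
  higher : ∑< n (λ k → lamHat n (suc k) * kraw n (suc k) w) ≡ - (p * S)
  higher = begin
    ∑< n (λ k → lamHat n (suc k) * kraw n (suc k) w)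
      ≡⟨ ∑<-cong n (λ k k<n → trans (cong (_* kraw n (suc k) w) (positive-coefficient n k k<n))
           (solve 3 (λ p h c → (:- (p :* h)) :* c := :- (p :* (h :* c))) refl p (H (suc k)) (kraw n (suc k) w))) ⟩
    ∑< n (λ k → - (p * (H (suc k) * kraw n (suc k) w)))
      ≡⟨ trans (∑ₗ-neg (upTo n) _) (cong -_ (∑ₗ-*ˡ (upTo n) p _)) ⟩
    - (p * S) ∎

*-nonNeg : ∀ {a b} → 0ℚ ≤ a → 0ℚ ≤ b → 0ℚ ≤ a * b
*-nonNeg {a} {b} 0≤a 0≤b = QP.nonNegative⁻¹ (a * b) {{QP.nonNeg*nonNeg⇒nonNeg a {{Q.nonNegative 0≤a}} b {{Q.nonNegative 0≤b}}}}

square-nonNeg : ∀ a → 0ℚ ≤ a * a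
square-nonNeg a with QP.≤-total 0ℚ a
... | inj₁ 0≤a = *-nonNeg 0≤a 0≤a
... | inj₂ a≤0 = subst (0ℚ ≤_) (solve 1 (λ x → (:- x) :* (:- x) := x :* x) refl a) (*-nonNeg 0≤-a 0≤-a)
  where 0≤-a = QP.neg-antimono-≤ a≤0

∑ₗ-nonNeg : {A : Set} (l : List A) (f : A → ℚ) → (∀ x → 0ℚ ≤ f x) → 0ℚ ≤ ∑ₗ l f
∑ₗ-nonNeg []      f _   = QP.≤-refl
∑ₗ-nonNeg (x ∷ l) f 0≤f = QP.+-mono-≤ (0≤f x) (∑ₗ-nonNeg l f 0≤f)

pow2inv-nonNeg : ∀ n → 0ℚ ≤ pow2inv n
pow2inv-nonNeg zero    = QP.nonNegative⁻¹ 1ℚ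
pow2inv-nonNeg (suc n) = *-nonNeg (QP.nonNegative⁻¹ ½) (pow2inv-nonNeg n)

lamHat-nonPos : ∀ n k → 1 ℕ.≤ k → 0ℚ ≤ - lamHat n k
lamHat-nonPos n (suc j) _ = subst (0ℚ ≤_) (solve 1 (λ x → x := :- (:- x)) refl X)
  (*-nonNeg (pow2inv-nonNeg n) (∑ₗ-nonNeg (upTo (suc (n ∸ 1))) _ (λ t → square-nonNeg (kraw (n ∸ 1) t j))))
  where X = pow2inv n * sumTo (n ∸ 1) (λ t → kraw (n ∸ 1) t j * kraw (n ∸ 1) t j)

corollary4p2 : (n : ℕ) →
    ((x y : Vec Bool n) → (w : ℕ) → ham x y ≡ w →
    lam x y ≡ sumTo n (λ k → lamHat n k * kraw n k w))
    × ((k : ℕ) → 1 ℕ.≤ k → k ℕ.≤ n → 0ℚ ≤ - lamHat n k)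
corollary4p2 n = (λ { x y _ refl → lam-expansion n x y }) , (λ k 1≤k _ → lamHat-nonPos n k 1≤k)
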